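{- Let $G$ be a biconnected simple graph and let $e$ be an edge with end vertices $u,v$ forming a separating face, so that $G$ is the union of subgraphs $G^{(1)}$ and $G^{(2)}$ which intersect exactly in the edge $e$ together with $u$ and $v$, where $G^{(2)}$ is bipartite. Then there is a generating set of the ideal $I_{\hat G}$ that contains no binomial corresponding to an even cycle of $G$ using edges of both $G^{(1)}-e$ and $G^{(2)}-e$.
   Context: An edge $e$ with end vertices $u,v$ is a separating face of $G$ if $G-\{u,v\}$ has more connected components than $G$; the decomposed pieces are obtained by adding $u$, $v$ and $e$ back to (unions of) components of $G-\{u,v\}$. To an even cycle with edges $a_1,b_2,a_3,b_4,\dots,a_{2m-1},b_{2m}$ in order corresponds the binomial $\prod_i a_{2i-1}-\prod_i b_{2i}$. $K$ is a field of characteristic zero; $K[E]$, $K[V]$ are polynomial rings with one variable per edge, resp. vertex; $\phi^*$ sends an edge to the product of its end vertices. Odd cycles of $G$ are $C_1,\dots,C_q$; a pair is exceptional if every path connecting them has length at least two; for each exceptional pair a variable $\theta_{ij}$ is introduced, $F=E\cup\{\theta_{ij}\}$, $\psi^*:K[F]\to K[V]$ extends $\phi^*$ by $\theta_{ij}\mapsto$ (product of vertices of $C_i$)(product of vertices of $C_j$), and $I_{\hat G}=\ker\psi^*$ (the ideal generated by all $t-u$ with $t,u$ monomials, $\psi^*(t)=\psi^*(u)$). -}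

module Defs where

open import Level using (Level; _⊔_; 0ℓ) renaming (suc to lsuc)
open import Data.Bool using (Bool; true; false)
open import Data.Nat as ℕ using (ℕ; zero; suc; _≤_)
open import Data.Fin as Fin using (Fin)
open import Data.Vec as Vec using (Vec; lookup; zipWith; replicate; _[_]≔_)
open import Data.Vec.Properties using (≡-dec)
open import Data.List as List using (List; []; _∷_; _++_; concatMap)
open import Data.List.Relation.Unary.Unique.Propositional using (Unique)
open import Data.List.Membership.Propositional using (_∈_)
open import Data.Product using (Σ; ∃; _×_; _,_; proj₁; proj₂)
open import Data.Product.Properties using () renaming (≡-dec to ×-≡-dec)
open import Data.Sum using (_⊎_)
open import Data.Empty using (⊥)
open import Relation.Binary.PropositionalEquality using (_≡_; _≢_)
open import Relation.Binary.Definitions using (DecidableEquality)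
open import Relation.Nullary using (¬_; yes; no)
open import Function.Bundles using (_⇔_)
open import Algebra.Bundles using (CommutativeRing)

record Field (c ℓ : Level) : Set (lsuc (c ⊔ ℓ)) where
  field
    commutativeRing : CommutativeRing c ℓ
  open CommutativeRing commutativeRing public
  field
    1≉0     : ¬ (1# ≈ 0#)
    inverse : ∀ x → ¬ (x ≈ 0#) → ∃ λ y → (x * y) ≈ 1#

natCast : ∀ {c ℓ} (K : Field c ℓ) → ℕ → Field.Carrier K
natCast K zero    = Field.0# K
natCast K (suc k) = Field._+_ K (Field.1# K) (natCast K k)

CharacteristicZero : ∀ {c ℓ} → Field c ℓ → Set ℓ
CharacteristicZero K = ∀ k → Field._≈_ K (natCast K k) (Field.0# K) → k ≡ 0

-- A polynomial is a finite formal sum, i.e. a list of (coefficient, monomial)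
-- terms; two polynomials are equal iff all their coefficients agree.

module Poly {c ℓ} (R : CommutativeRing c ℓ) {M : Set}
            (_≟M_ : DecidableEquality M) (_·_ : M → M → M) where
  open CommutativeRing R

  Polynomial : Set c
  Polynomial = List (Carrier × M)

  coeff : Polynomial → M → Carrier
  coeff []            μ = 0#
  coeff ((a , ν) ∷ f) μ with ν ≟M μ
  ... | yes _ = a + coeff f μ
  ... | no  _ = coeff f μ

  _≈ₚ_ : Polynomial → Polynomial → Set ℓ
  f ≈ₚ g = ∀ μ → coeff f μ ≈ coeff g μ

  IsZero : Polynomial → Set ℓ
  IsZero f = ∀ μ → coeff f μ ≈ 0#

  _*ₚ_ : Polynomial → Polynomial → Polynomial
  f *ₚ g = concatMap (λ t → List.map (λ s → (proj₁ t * proj₁ s , proj₂ t · proj₂ s)) g) f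

  binomial : M → M → Polynomial
  binomial t u = (1# , t) ∷ (- 1# , u) ∷ []

  data Combination (P : Polynomial → Set c) (S : M → M → Set) : Polynomial → Set c where
    none : Combination P S []
    add  : ∀ {h} (g : Polynomial) (t u : M) → P g → S t u →
           Combination P S h → Combination P S ((g *ₚ binomial t u) ++ h)

  -- membership in the ideal generated by the binomials t - u, (t , u) ∈ S,
  -- inside the subring of polynomials satisfying P
  InIdeal : (P : Polynomial → Set c) (S : M → M → Set) → Polynomial → Set (c ⊔ ℓ)
  InIdeal P S f = ∃ λ h → Combination P S h × (f ≈ₚ h)

record Graph (n m : ℕ) : Set where
  field
    src tgt : Fin m → Fin n

module _ {n m : ℕ} (G : Graph n m) where
  open Graph G

  Joins : Fin m → Fin n → Fin n → Set
  Joins e x y = (src e ≡ x × tgt e ≡ y) ⊎ (src e ≡ y × tgt e ≡ x)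

  record IsSimple : Set where
    field
      loopless : ∀ e → src e ≢ tgt e
      noMulti  : ∀ e e' x y → Joins e x y → Joins e' x y → e ≡ e'

  data Walk : Fin n → Fin n → Set where
    []   : ∀ {x} → Walk x x
    step : ∀ {x y z} (e : Fin m) → Joins e x y → Walk y z → Walk x z

  verts : ∀ {x y} → Walk x y → List (Fin n)
  verts {x} []           = x ∷ []
  verts {x} (step e j w) = x ∷ verts w

  edges : ∀ {x y} → Walk x y → List (Fin m)
  edges []           = []
  edges (step e j w) = e ∷ edges w

  len : ∀ {x y} → Walk x y → ℕ
  len []           = 0
  len (step e j w) = suc (len w)

  IsPath : ∀ {x y} → Walk x y → Set
  IsPath w = Unique (verts w)

  -- vertices of a closed walk, each listed once (the initial vertex is
  -- listed only at the end)
  cycleVerts : ∀ {x y} → Walk x y → List (Fin n)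
  cycleVerts []           = []
  cycleVerts (step e j w) = verts w

  IsCycle : ∀ {x} → Walk x x → Set
  IsCycle w = (3 ≤ len w) × Unique (cycleVerts w)

  ConnectedAvoiding : (Fin n → Set) → Set
  ConnectedAvoiding X = ∀ x y → ¬ X x → ¬ X y →
    ∃ λ (w : Walk x y) → ∀ z → z ∈ verts w → ¬ X z

  Connected : Set
  Connected = ConnectedAvoiding (λ _ → ⊥)

  Biconnected : Set
  Biconnected = Connected × (∀ a → ConnectedAvoiding (λ z → z ≡ a))

  -- for a connected graph: G - {u,v} has more connected components than G,
  -- i.e. G - {u,v} is disconnected
  SeparatingFace : Fin m → Fin n → Fin n → Set
  SeparatingFace e u v =
    Joins e u v × ¬ ConnectedAvoiding (λ z → (z ≡ u) ⊎ (z ≡ v))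

  -- two cycles are the same subgraph iff they have the same edges
  SameEdges : ∀ {x y} → Walk x x → Walk y y → Set
  SameEdges w w' = ∀ f → (f ∈ edges w) ⇔ (f ∈ edges w')

  -- (odd-position edge exponents , even-position edge exponents)
  -- of a walk whose edges are a₁ , b₂ , a₃ , b₄ , ...
  unitE : Fin m → Vec ℕ m
  unitE e = replicate m 0 [ e ]≔ 1

  alt : ∀ {x y} → Walk x y → Vec ℕ m × Vec ℕ m
  alt []           = replicate m 0 , replicate m 0
  alt (step e j w) = zipWith ℕ._+_ (unitE e) (proj₂ (alt w)) , proj₁ (alt w)

Even Odd : ℕ → Set
Even k = ∃ λ j → k ≡ j ℕ.+ j
Odd  k = ∃ λ j → k ≡ suc (j ℕ.+ j)

-- Vertex monomials (exponent vectors in K[V])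

unitV : ∀ {n} → Fin n → Vec ℕ n
unitV {n} x = replicate n 0 [ x ]≔ 1

_⊕_ : ∀ {k} → Vec ℕ k → Vec ℕ k → Vec ℕ k
_⊕_ = zipWith ℕ._+_

zeroV : ∀ {k} → Vec ℕ k
zeroV {k} = replicate k 0

sumV : ∀ {k} → List (Vec ℕ k) → Vec ℕ k
sumV = List.foldr _⊕_ zeroV

scaleV : ∀ {k} → ℕ → Vec ℕ k → Vec ℕ k
scaleV a = Vec.map (a ℕ.*_)

sumFin : ∀ {l k} → (Fin k → Vec ℕ l) → Vec ℕ l
sumFin {k = k} f = sumV (List.map f (List.allFin k))

-- The setting of the lemma: a graph with an enumeration C₁ … C_q of its
-- odd cycles, the variables F = E ∪ {θ_ij}, the map ψ*, the ideal I_Ĝ.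

record OddCycleEnumeration {n m} (G : Graph n m) : Set where
  field
    q       : ℕ
    base    : Fin q → Fin n
    cyc     : (i : Fin q) → Walk G (base i) (base i)
    isCycle : ∀ i → IsCycle G (cyc i)
    isOdd   : ∀ i → Odd (len G (cyc i))
    complete : ∀ x (w : Walk G x x) → IsCycle G w → Odd (len G w) →
               ∃ λ i → SameEdges G w (cyc i)
    distinct : ∀ i j → SameEdges G (cyc i) (cyc j) → i ≡ j

module Setting {c ℓ} (K : Field c ℓ) {n m} (G : Graph n m)
               (Cs : OddCycleEnumeration G) where
  open OddCycleEnumeration Cs

  Exceptional : Fin q → Fin q → Set
  Exceptional i j = ∀ x y → x ∈ cycleVerts G (cyc i) → y ∈ cycleVerts G (cyc j) →
    (p : Walk G x y) → IsPath G p → 2 ≤ len G p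

  -- monomials in the variables E ∪ {θ_ij : i,j arbitrary}:
  -- exponents of the edge variables, and a q×q matrix of θ exponents
  Mono : Set
  Mono = Vec ℕ m × Vec (Vec ℕ q) q

  -- monomials of K[F]: θ_ij only occurs for i < j with (C_i , C_j) exceptional
  ValidMono : Mono → Set
  ValidMono μ = ∀ i j → lookup (lookup (proj₂ μ) i) j ≢ 0 →
                (i Fin.< j) × Exceptional i j

  _≟Mono_ : DecidableEquality Mono
  _≟Mono_ = ×-≡-dec (≡-dec ℕ._≟_) (≡-dec (≡-dec ℕ._≟_))

  _·_ : Mono → Mono → Mono
  (a , s) · (b , t) = zipWith ℕ._+_ a b , zipWith (zipWith ℕ._+_) s t

  edgeMono : Vec ℕ m → Mono
  edgeMono a = a , replicate q (replicate q 0)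

  _≟V_ : DecidableEquality (Vec ℕ n)
  _≟V_ = ≡-dec ℕ._≟_

  module KF = Poly (Field.commutativeRing K) _≟Mono_ _·_
  module KV = Poly (Field.commutativeRing K) _≟V_ _⊕_

  cycleMono : Fin q → Vec ℕ n
  cycleMono i = sumV (List.map unitV (cycleVerts G (cyc i)))

  ψ : Mono → Vec ℕ n
  ψ (a , s) =
    sumFin (λ e → scaleV (lookup a e) (unitV (Graph.src G e) ⊕ unitV (Graph.tgt G e)))
    ⊕ sumFin (λ i → sumFin (λ j → scaleV (lookup (lookup s i) j)
                                          (cycleMono i ⊕ cycleMono j)))

  ψ* : KF.Polynomial → KV.Polynomial
  ψ* = List.map (λ t → proj₁ t , ψ (proj₂ t))

  InKF : KF.Polynomial → Set c
  InKF f = ∀ t → t ∈ f → ValidMono (proj₂ t)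

  InI : KF.Polynomial → Set ℓ
  InI f = KV.IsZero (ψ* f)

-- The decomposition along the separating face e = uv:
-- side x tells for a vertex x ∉ {u,v} whether it lies in G⁽¹⁾ (false)
-- or in G⁽²⁾ (true); u, v and e belong to both pieces.

module Decomposition {n m} (G : Graph n m) (e : Fin m) (u v : Fin n)
                     (side : Fin n → Bool) where

  OffUV : Fin n → Set
  OffUV x = ¬ ((x ≡ u) ⊎ (x ≡ v))

  -- G = G⁽¹⁾ ∪ G⁽²⁾ with G⁽¹⁾ ∩ G⁽²⁾ = ({u,v},{e}): no edge joins a vertex
  -- of G⁽¹⁾ - {u,v} to a vertex of G⁽²⁾ - {u,v}
  IsSplit : Set
  IsSplit = ∀ f x y → Joins G f x y → OffUV x → OffUV y → side x ≡ side y

  InPieceMinusE : Bool → Fin m → Set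
  InPieceMinusE b f = f ≢ e × ∃ λ x → (∃ λ y → Joins G f x y) × OffUV x × side x ≡ b

  PieceBipartite : Bool → Set
  PieceBipartite b = ∃ λ (col : Fin n → Bool) → ∀ f x y → Joins G f x y →
    ((f ≡ e) ⊎ InPieceMinusE b f) → col x ≢ col y

  MixedEvenCycle : ∀ {x} → Walk G x x → Set
  MixedEvenCycle w = IsCycle G w × Even (len G w)
    × (∃ λ f → f ∈ edges G w × InPieceMinusE false f)
    × (∃ λ f → f ∈ edges G w × InPieceMinusE true f)

  module Binomials {c ℓ} (K : Field c ℓ) (Cs : OddCycleEnumeration G) where
    open Setting K G Cs

    MixedCycleBinomial : Mono → Mono → Set
    MixedCycleBinomial t s = ∃ λ x → ∃ λ (w : Walk G x x) → MixedEvenCycle w ×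
      (((t ≡ edgeMono (proj₁ (alt G w))) × (s ≡ edgeMono (proj₂ (alt G w))))
       ⊎ ((t ≡ edgeMono (proj₂ (alt G w))) × (s ≡ edgeMono (proj₁ (alt G w)))))

-- The kernel of ψ* is spanned, already as a vector space, by binomials t - s with
-- ψ t = ψ s: replacing every monomial of a kernel element by a fixed representative
-- of its ψ-fibre is a monomial map that factors through ψ, hence kills the element,
-- and what remains is a sum of such differences. So the kernel binomials generate
-- I_Ĝ, and a mixed even-cycle binomial t - s can be dropped as soon as its fibre
-- contains a "hub" ρ that lies in no mixed binomial: then t - s = (t - ρ) + (ρ - s).
--
-- A mixed even cycle passes through u and v and splits there into a u–v path A in
-- G⁽²⁾ and a v–u path B in G⁽¹⁾, neither using e (G is simple). G⁽²⁾ is bipartite and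
-- contains e, so A is odd, hence so is B. Writing both with alternating edges
-- a₁b₂⋯a_{2k+1}, the monomial ρ = (b-edges of A)(b-edges of B)·e has the same image as
-- the cycle binomials, and it contains e while no mixed cycle does. Whether a fibre
-- contains such an edge monomial is decidable by a bounded search.

module Submission where

open import Defs
open import Data.Bool using (Bool; true; false)
open import Data.Fin using (Fin)
open import Data.Product using (∃; _×_)
open import Relation.Binary.PropositionalEquality using (_≡_)
open import Relation.Nullary using (¬_)
open import Function.Bundles using (_⇔_)

open import Data.Nat using (ℕ; zero; suc)
import Data.Fin as Fin
open import Data.Vec using (Vec; []; _∷_; lookup; replicate; zipWith)
open import Data.List as List using (List; []; _∷_; _++_)
open import Data.List.Membership.Propositional using (_∈_)
import Data.List.Relation.Unary.Any as Any
open import Data.Product using (Σ; _,_; proj₁; proj₂)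
open import Data.Sum using (_⊎_; inj₁; inj₂)
open import Data.Empty using (⊥; ⊥-elim)
open import Relation.Binary.PropositionalEquality
  using (_≢_; refl; sym; trans; cong; cong₂; subst; module ≡-Reasoning)
open import Relation.Binary.Definitions using (DecidableEquality)
open import Relation.Nullary using (Dec; yes; no; ¬?)
open import Function using (_∘_)
open import Algebra.Bundles using (CommutativeRing)

-- Exponent vectors

module _ where
  open import Data.Nat using (_+_; _*_; _≤_; s≤s)
  open import Data.Nat.Properties
    using (+-comm; +-assoc; +-identityˡ; +-identityʳ; *-distribʳ-+; +-cancelʳ-≡;
           m≤m+n; m≤n+m; ≤-trans; ≤-reflexive)
  open import Data.Vec.Properties
    using (zipWith-comm; zipWith-assoc; zipWith-identityˡ; zipWith-identityʳ;
           lookup-zipWith; lookup-map; lookup∘update; ∷-injective)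
  open import Data.List.Properties using (map-tabulate; map-cong)
  open import Data.List.Membership.Propositional.Properties
    using (∈-upTo⁺; ∈-cartesianProductWith⁺)
  open import Data.List.Relation.Unary.Any using (any?; satisfied)
  open import Data.List.Membership.Propositional using (lose)
  open import Relation.Unary using (Decidable)

  module _ {k : ℕ} where

    ⊕-comm : (x y : Vec ℕ k) → x ⊕ y ≡ y ⊕ x
    ⊕-comm = zipWith-comm +-comm

    ⊕-assoc : (x y z : Vec ℕ k) → (x ⊕ y) ⊕ z ≡ x ⊕ (y ⊕ z)
    ⊕-assoc = zipWith-assoc +-assoc

    ⊕-identityˡ : (x : Vec ℕ k) → zeroV ⊕ x ≡ x
    ⊕-identityˡ = zipWith-identityˡ +-identityˡ

    ⊕-identityʳ : (x : Vec ℕ k) → x ⊕ zeroV ≡ x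
    ⊕-identityʳ = zipWith-identityʳ +-identityʳ

    ⊕-interchange : (a b c d : Vec ℕ k) → (a ⊕ b) ⊕ (c ⊕ d) ≡ (a ⊕ c) ⊕ (b ⊕ d)
    ⊕-interchange a b c d = begin
      (a ⊕ b) ⊕ (c ⊕ d)  ≡⟨ ⊕-assoc a b (c ⊕ d) ⟩
      a ⊕ (b ⊕ (c ⊕ d))  ≡⟨ cong (a ⊕_) (sym (⊕-assoc b c d)) ⟩
      a ⊕ ((b ⊕ c) ⊕ d)  ≡⟨ cong (λ x → a ⊕ (x ⊕ d)) (⊕-comm b c) ⟩
      a ⊕ ((c ⊕ b) ⊕ d)  ≡⟨ cong (a ⊕_) (⊕-assoc c b d) ⟩
      a ⊕ (c ⊕ (b ⊕ d))  ≡⟨ sym (⊕-assoc a c (b ⊕ d)) ⟩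
      (a ⊕ c) ⊕ (b ⊕ d)  ∎
      where open ≡-Reasoning

    lookup-⊕ : (x y : Vec ℕ k) (i : Fin k) → lookup (x ⊕ y) i ≡ lookup x i + lookup y i
    lookup-⊕ x y i = lookup-zipWith _+_ i x y

    sumV-map-⊕ : ∀ {A : Set} (F G : A → Vec ℕ k) (l : List A) →
      sumV (List.map (λ x → F x ⊕ G x) l) ≡ sumV (List.map F l) ⊕ sumV (List.map G l)
    sumV-map-⊕ F G []      = sym (⊕-identityʳ zeroV)
    sumV-map-⊕ F G (x ∷ l) =
      trans (cong ((F x ⊕ G x) ⊕_) (sumV-map-⊕ F G l)) (⊕-interchange (F x) (G x) _ _)

  ⊕-cancelʳ : ∀ {k} (x y z : Vec ℕ k) → x ⊕ z ≡ y ⊕ z → x ≡ y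
  ⊕-cancelʳ []      []      []      _  = refl
  ⊕-cancelʳ (a ∷ x) (b ∷ y) (c ∷ z) eq =
    cong₂ _∷_ (+-cancelʳ-≡ c a b (proj₁ (∷-injective eq))) (⊕-cancelʳ x y z (proj₂ (∷-injective eq)))

  lookup-unitV-self : ∀ {k} (i : Fin k) → lookup (unitV i) i ≡ 1
  lookup-unitV-self i = lookup∘update i zeroV 1

  scaleV-distribʳ : ∀ {k} a b (v : Vec ℕ k) → scaleV (a + b) v ≡ scaleV a v ⊕ scaleV b v
  scaleV-distribʳ a b []      = refl
  scaleV-distribʳ a b (x ∷ v) = cong₂ _∷_ (*-distribʳ-+ x a b) (scaleV-distribʳ a b v)

  scaleV-zeroˡ : ∀ {k} (v : Vec ℕ k) → scaleV 0 v ≡ zeroV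
  scaleV-zeroˡ []      = refl
  scaleV-zeroˡ (x ∷ v) = cong (0 ∷_) (scaleV-zeroˡ v)

  scaleV-identityˡ : ∀ {k} (v : Vec ℕ k) → scaleV 1 v ≡ v
  scaleV-identityˡ []      = refl
  scaleV-identityˡ (x ∷ v) = cong₂ _∷_ (+-identityʳ x) (scaleV-identityˡ v)

  module _ {l : ℕ} where

    sumFin-suc : ∀ {k} (F : Fin (suc k) → Vec ℕ l) → sumFin F ≡ F Fin.zero ⊕ sumFin (F ∘ Fin.suc)
    sumFin-suc {k} F = cong (λ xs → F Fin.zero ⊕ sumV xs)
      (trans (map-tabulate Fin.suc F) (sym (map-tabulate (λ i → i) (F ∘ Fin.suc))))

    sumFin-cong : ∀ {k} {F G : Fin k → Vec ℕ l} → (∀ i → F i ≡ G i) → sumFin F ≡ sumFin G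
    sumFin-cong {k} F≗G = cong sumV (map-cong F≗G (List.allFin k))

    sumFin-⊕ : ∀ {k} (F G : Fin k → Vec ℕ l) → sumFin (λ i → F i ⊕ G i) ≡ sumFin F ⊕ sumFin G
    sumFin-⊕ {k} F G = sumV-map-⊕ F G (List.allFin k)

    sumFin-zero : ∀ k → sumFin {l} {k} (λ _ → zeroV) ≡ zeroV
    sumFin-zero zero    = refl
    sumFin-zero (suc k) = trans (sumFin-suc {k} (λ _ → zeroV)) (trans (⊕-identityˡ _) (sumFin-zero k))

    linComb : ∀ {k} → (Fin k → Vec ℕ l) → Vec ℕ k → Vec ℕ l
    linComb V a = sumFin (λ j → scaleV (lookup a j) (V j))

    linComb-∷ : ∀ {k} (V : Fin (suc k) → Vec ℕ l) x (a : Vec ℕ k) →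
      linComb V (x ∷ a) ≡ scaleV x (V Fin.zero) ⊕ linComb (V ∘ Fin.suc) a
    linComb-∷ V x a = sumFin-suc (λ j → scaleV (lookup (x ∷ a) j) (V j))

    linComb-⊕ : ∀ {k} (V : Fin k → Vec ℕ l) a b → linComb V (a ⊕ b) ≡ linComb V a ⊕ linComb V b
    linComb-⊕ V []      []      = sym (⊕-identityʳ zeroV)
    linComb-⊕ V (x ∷ a) (y ∷ b) = begin
      linComb V ((x + y) ∷ (a ⊕ b))
        ≡⟨ linComb-∷ V (x + y) (a ⊕ b) ⟩
      scaleV (x + y) (V Fin.zero) ⊕ linComb (V ∘ Fin.suc) (a ⊕ b)
        ≡⟨ cong₂ _⊕_ (scaleV-distribʳ x y (V Fin.zero)) (linComb-⊕ (V ∘ Fin.suc) a b) ⟩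
      (scaleV x (V Fin.zero) ⊕ scaleV y (V Fin.zero)) ⊕ (linComb (V ∘ Fin.suc) a ⊕ linComb (V ∘ Fin.suc) b)
        ≡⟨ ⊕-interchange _ _ _ _ ⟩
      (scaleV x (V Fin.zero) ⊕ linComb (V ∘ Fin.suc) a) ⊕ (scaleV y (V Fin.zero) ⊕ linComb (V ∘ Fin.suc) b)
        ≡⟨ sym (cong₂ _⊕_ (linComb-∷ V x a) (linComb-∷ V y b)) ⟩
      linComb V (x ∷ a) ⊕ linComb V (y ∷ b) ∎
      where open ≡-Reasoning

    linComb-zero : ∀ {k} (V : Fin k → Vec ℕ l) → linComb V zeroV ≡ zeroV
    linComb-zero {zero}  V = refl
    linComb-zero {suc k} V = trans (linComb-∷ V 0 zeroV)
      (trans (cong₂ _⊕_ (scaleV-zeroˡ (V Fin.zero)) (linComb-zero (V ∘ Fin.suc))) (⊕-identityˡ zeroV))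

    linComb-unit : ∀ {k} (V : Fin k → Vec ℕ l) c → linComb V (unitV c) ≡ V c
    linComb-unit V Fin.zero = trans (linComb-∷ V 1 zeroV)
      (trans (cong₂ _⊕_ (scaleV-identityˡ (V Fin.zero)) (linComb-zero (V ∘ Fin.suc))) (⊕-identityʳ _))
    linComb-unit V (Fin.suc c) = trans (linComb-∷ V 0 (unitV c))
      (trans (cong₂ _⊕_ (scaleV-zeroˡ (V Fin.zero)) (linComb-unit (V ∘ Fin.suc) c)) (⊕-identityˡ _))

    linComb-≥ : ∀ {k} (V : Fin k → Vec ℕ l) a j i → lookup a j * lookup (V j) i ≤ lookup (linComb V a) i
    linComb-≥ V (x ∷ a) j i rewrite linComb-∷ V x a | lookup-⊕ (scaleV x (V Fin.zero)) (linComb (V ∘ Fin.suc) a) i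
      with j
    ... | Fin.zero  = ≤-trans (≤-reflexive (sym (lookup-map i (x *_) (V Fin.zero)))) (m≤m+n _ _)
    ... | Fin.suc j = ≤-trans (linComb-≥ (V ∘ Fin.suc) a j i) (m≤n+m _ _)

  boundedBy : ∀ {k} → Vec ℕ k → List (Vec ℕ k)
  boundedBy []      = [] ∷ []
  boundedBy (x ∷ b) = List.cartesianProductWith _∷_ (List.upTo (suc x)) (boundedBy b)

  ∈-boundedBy : ∀ {k} {a : Vec ℕ k} b → (∀ i → lookup a i ≤ lookup b i) → a ∈ boundedBy b
  ∈-boundedBy {a = []}    []      _   = Any.here refl
  ∈-boundedBy {a = y ∷ a} (x ∷ b) a≤b =
    ∈-cartesianProductWith⁺ _∷_ (∈-upTo⁺ (s≤s (a≤b Fin.zero))) (∈-boundedBy b (a≤b ∘ Fin.suc))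

  ∃-bounded? : ∀ {k p} {P : Vec ℕ k → Set p} → Decidable P → (b : Vec ℕ k) →
    (∀ a → P a → ∀ i → lookup a i ≤ lookup b i) → Dec (∃ P)
  ∃-bounded? P? b bound with any? P? (boundedBy b)
  ... | yes found = yes (satisfied found)
  ... | no  none  = no λ (a , pa) → none (lose (∈-boundedBy b (bound a pa)) pa)

-- Polynomials

module PolyProperties {c ℓ} (R : CommutativeRing c ℓ) {M : Set}
                      (_≟M_ : DecidableEquality M) (_·_ : M → M → M) where
  open CommutativeRing R renaming (refl to ≈-refl; sym to ≈-sym; trans to ≈-trans)
  open Poly R _≟M_ _·_
  open import Relation.Binary.Reasoning.Setoid setoid

  termCoeff : Carrier → M → M → Carrier
  termCoeff a ν μ with ν ≟M μ
  ... | yes _ = a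
  ... | no  _ = 0#

  coeff-∷ : ∀ a ν f μ → coeff ((a , ν) ∷ f) μ ≈ termCoeff a ν μ + coeff f μ
  coeff-∷ a ν f μ with ν ≟M μ
  ... | yes _ = ≈-refl
  ... | no  _ = ≈-sym (+-identityˡ _)

  termCoeff-other : ∀ a {ν μ} → ν ≢ μ → termCoeff a ν μ ≈ 0#
  termCoeff-other a {ν} {μ} ν≢μ with ν ≟M μ
  ... | yes ν≡μ = ⊥-elim (ν≢μ ν≡μ)
  ... | no  _   = ≈-refl

  termCoeff-cong : ∀ {a b} ν μ → a ≈ b → termCoeff a ν μ ≈ termCoeff b ν μ
  termCoeff-cong ν μ a≈b with ν ≟M μ
  ... | yes _ = a≈b
  ... | no  _ = ≈-refl

  termCoeff-zero : ∀ ν μ → termCoeff 0# ν μ ≈ 0#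
  termCoeff-zero ν μ with ν ≟M μ
  ... | yes _ = ≈-refl
  ... | no  _ = ≈-refl

  termCoeff-+ : ∀ a b ν μ → termCoeff a ν μ + termCoeff b ν μ ≈ termCoeff (a + b) ν μ
  termCoeff-+ a b ν μ with ν ≟M μ
  ... | yes _ = ≈-refl
  ... | no  _ = +-identityˡ 0#

  termCoeff-inverseʳ : ∀ a ν μ → termCoeff a ν μ + termCoeff (- a) ν μ ≈ 0#
  termCoeff-inverseʳ a ν μ with ν ≟M μ
  ... | yes _ = -‿inverseʳ a
  ... | no  _ = +-identityˡ 0#

  coeff-++ : ∀ f g μ → coeff (f ++ g) μ ≈ coeff f μ + coeff g μ
  coeff-++ []            g μ = ≈-sym (+-identityˡ _)
  coeff-++ ((a , ν) ∷ f) g μ = begin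
    coeff ((a , ν) ∷ (f ++ g)) μ              ≈⟨ coeff-∷ a ν (f ++ g) μ ⟩
    termCoeff a ν μ + coeff (f ++ g) μ        ≈⟨ +-congˡ (coeff-++ f g μ) ⟩
    termCoeff a ν μ + (coeff f μ + coeff g μ) ≈⟨ ≈-sym (+-assoc _ _ _) ⟩
    (termCoeff a ν μ + coeff f μ) + coeff g μ ≈⟨ +-congʳ (≈-sym (coeff-∷ a ν f μ)) ⟩
    coeff ((a , ν) ∷ f) μ + coeff g μ         ∎

  ≈ₚ-trans : ∀ {f g h} → f ≈ₚ g → g ≈ₚ h → f ≈ₚ h
  ≈ₚ-trans f≈g g≈h μ = ≈-trans (f≈g μ) (g≈h μ)

  ≈ₚ-∷ : ∀ {a b μ ν f g} → a ≈ b → μ ≡ ν → f ≈ₚ g → ((a , μ) ∷ f) ≈ₚ ((b , ν) ∷ g)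
  ≈ₚ-∷ {a} {b} {μ} {f = f} {g} a≈b refl f≈g λ′ = begin
    coeff ((a , μ) ∷ f) λ′           ≈⟨ coeff-∷ a μ f λ′ ⟩
    termCoeff a μ λ′ + coeff f λ′    ≈⟨ +-cong (termCoeff-cong μ λ′ a≈b) (f≈g λ′) ⟩
    termCoeff b μ λ′ + coeff g λ′    ≈⟨ ≈-sym (coeff-∷ b μ g λ′) ⟩
    coeff ((b , μ) ∷ g) λ′           ∎

  ≈ₚ-++ : ∀ {f f′ g g′} → f ≈ₚ f′ → g ≈ₚ g′ → (f ++ g) ≈ₚ (f′ ++ g′)
  ≈ₚ-++ {f} {f′} {g} {g′} f≈f′ g≈g′ μ = begin
    coeff (f ++ g) μ          ≈⟨ coeff-++ f g μ ⟩
    coeff f μ + coeff g μ     ≈⟨ +-cong (f≈f′ μ) (g≈g′ μ) ⟩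
    coeff f′ μ + coeff g′ μ   ≈⟨ ≈-sym (coeff-++ f′ g′ μ) ⟩
    coeff (f′ ++ g′) μ        ∎

  binomial-detour : ∀ b t ρ s →
    ((b , t) ∷ (- b , ρ) ∷ (b , ρ) ∷ (- b , s) ∷ []) ≈ₚ ((b , t) ∷ (- b , s) ∷ [])
  binomial-detour b t ρ s μ = begin
    coeff ((b , t) ∷ (- b , ρ) ∷ rest) μ
      ≈⟨ coeff-∷ b t _ μ ⟩
    termCoeff b t μ + coeff ((- b , ρ) ∷ rest) μ
      ≈⟨ +-congˡ (coeff-∷ (- b) ρ rest μ) ⟩
    termCoeff b t μ + (termCoeff (- b) ρ μ + coeff rest μ)
      ≈⟨ +-congˡ (+-congˡ (coeff-∷ b ρ _ μ)) ⟩
    termCoeff b t μ + (termCoeff (- b) ρ μ + (termCoeff b ρ μ + coeff ((- b , s) ∷ []) μ))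
      ≈⟨ +-congˡ (≈-sym (+-assoc _ _ _)) ⟩
    termCoeff b t μ + ((termCoeff (- b) ρ μ + termCoeff b ρ μ) + coeff ((- b , s) ∷ []) μ)
      ≈⟨ +-congˡ (+-congʳ (≈-trans (+-comm _ _) (termCoeff-inverseʳ b ρ μ))) ⟩
    termCoeff b t μ + (0# + coeff ((- b , s) ∷ []) μ)
      ≈⟨ +-congˡ (+-identityˡ _) ⟩
    termCoeff b t μ + coeff ((- b , s) ∷ []) μ
      ≈⟨ ≈-sym (coeff-∷ b t _ μ) ⟩
    coeff ((b , t) ∷ (- b , s) ∷ []) μ ∎
    where rest = (b , ρ) ∷ (- b , s) ∷ []

  data BinomialSum (S : M → M → Set) : Polynomial → Set c where
    []   : BinomialSum S []
    cons : ∀ {h} b {μ ν} → S μ ν → BinomialSum S h → BinomialSum S ((b , μ) ∷ (- b , ν) ∷ h)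

  Combination-++ : ∀ {P S h h′} → Combination P S h → Combination P S h′ → Combination P S (h ++ h′)
  Combination-++ none                      c′ = c′
  Combination-++ {h′ = h′} (add {h} g t u Pg Stu c) c′ =
    subst (Combination _ _) (sym (++-assoc (g *ₚ binomial t u) h h′)) (add g t u Pg Stu (Combination-++ c c′))
    where open import Data.List.Properties using (++-assoc)

  InIdeal-++ : ∀ {P S f g} → InIdeal P S f → InIdeal P S g → InIdeal P S (f ++ g)
  InIdeal-++ {f = f} {g} (h , c , f≈h) (h′ , c′ , g≈h′) =
    h ++ h′ , Combination-++ c c′ , ≈ₚ-++ {f} {h} {g} {h′} f≈h g≈h′

  InIdeal-resp : ∀ {P S f g} → f ≈ₚ g → InIdeal P S g → InIdeal P S f
  InIdeal-resp {f = f} {g} f≈g (h , c , g≈h) = h , c , ≈ₚ-trans {f} {g} {h} f≈g g≈h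

module MonomialMap {c ℓ} (R : CommutativeRing c ℓ)
                   {M : Set} (_≟M_ : DecidableEquality M) (_·_ : M → M → M)
                   {N : Set} (_≟N_ : DecidableEquality N) (_∙_ : N → N → N)
                   (φ : M → N) where
  open CommutativeRing R renaming (refl to ≈-refl; sym to ≈-sym; trans to ≈-trans)
  open import Relation.Binary.Reasoning.Setoid setoid
  open import Algebra.Properties.CommutativeSemigroup +-commutativeSemigroup using (x∙yz≈y∙xz)
  import Data.Nat as ℕ
  open import Data.Nat.Properties using (≤-refl; ≤-trans; +-mono-≤)
  open import Data.List.Properties using (length-filter; filter-reject)
  open Poly R _≟M_ _·_
  open PolyProperties R _≟M_ _·_
  module T where
    open Poly R _≟N_ _∙_ public
    open PolyProperties R _≟N_ _∙_ public

  mapMonomials : Polynomial → T.Polynomial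
  mapMonomials = List.map (λ t → proj₁ t , φ (proj₂ t))

  without : M → Polynomial → Polynomial
  without ν = List.filter (λ t → ¬? (proj₂ t ≟M ν))

  coeff-without-self : ∀ ν p → coeff (without ν p) ν ≈ 0#
  coeff-without-self ν []            = ≈-refl
  coeff-without-self ν ((a , μ) ∷ p) with μ ≟M ν
  ... | yes refl = coeff-without-self ν p
  ... | no μ≢ν = begin
    coeff ((a , μ) ∷ without ν p) ν            ≈⟨ coeff-∷ a μ _ ν ⟩
    termCoeff a μ ν + coeff (without ν p) ν    ≈⟨ +-cong (termCoeff-other a μ≢ν) (coeff-without-self ν p) ⟩
    0# + 0#                                    ≈⟨ +-identityˡ 0# ⟩
    0#                                         ∎

  coeff-without-other : ∀ {ν μ} p → ν ≢ μ → coeff (without ν p) μ ≈ coeff p μ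
  coeff-without-other             []            _   = ≈-refl
  coeff-without-other {ν} {μ′} ((a , μ) ∷ p) ν≢μ′ with μ ≟M ν
  ... | yes refl = begin
    coeff (without ν p) μ′                   ≈⟨ coeff-without-other p ν≢μ′ ⟩
    coeff p μ′                               ≈⟨ ≈-sym (+-identityˡ _) ⟩
    0# + coeff p μ′                          ≈⟨ +-congʳ (≈-sym (termCoeff-other a ν≢μ′)) ⟩
    termCoeff a ν μ′ + coeff p μ′            ≈⟨ ≈-sym (coeff-∷ a ν p μ′) ⟩
    coeff ((a , ν) ∷ p) μ′                   ∎
  ... | no μ≢ν =
    ≈-trans (coeff-∷ a μ _ μ′) (≈-trans (+-congˡ (coeff-without-other p ν≢μ′)) (≈-sym (coeff-∷ a μ p μ′)))

  coeff-mapMonomials-split : ∀ ν p w →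
    T.coeff (mapMonomials p) w ≈ T.termCoeff (coeff p ν) (φ ν) w + T.coeff (mapMonomials (without ν p)) w
  coeff-mapMonomials-split ν []            w = ≈-sym (≈-trans (+-identityʳ _) (T.termCoeff-zero (φ ν) w))
  coeff-mapMonomials-split ν ((a , μ) ∷ p) w with μ ≟M ν
  ... | yes refl = begin
    T.coeff ((a , φ ν) ∷ mapMonomials p) w
      ≈⟨ T.coeff-∷ a (φ ν) _ w ⟩
    T.termCoeff a (φ ν) w + T.coeff (mapMonomials p) w
      ≈⟨ +-congˡ (coeff-mapMonomials-split ν p w) ⟩
    T.termCoeff a (φ ν) w + (T.termCoeff (coeff p ν) (φ ν) w + rest)
      ≈⟨ ≈-sym (+-assoc _ _ _) ⟩
    (T.termCoeff a (φ ν) w + T.termCoeff (coeff p ν) (φ ν) w) + rest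
      ≈⟨ +-congʳ (T.termCoeff-+ a (coeff p ν) (φ ν) w) ⟩
    T.termCoeff (a + coeff p ν) (φ ν) w + rest ∎
    where rest = T.coeff (mapMonomials (without ν p)) w
  ... | no μ≢ν = begin
    T.coeff ((a , φ μ) ∷ mapMonomials p) w
      ≈⟨ T.coeff-∷ a (φ μ) _ w ⟩
    T.termCoeff a (φ μ) w + T.coeff (mapMonomials p) w
      ≈⟨ +-congˡ (coeff-mapMonomials-split ν p w) ⟩
    T.termCoeff a (φ μ) w + (T.termCoeff (coeff p ν) (φ ν) w + rest)
      ≈⟨ x∙yz≈y∙xz _ _ _ ⟩
    T.termCoeff (coeff p ν) (φ ν) w + (T.termCoeff a (φ μ) w + rest)
      ≈⟨ +-congˡ (≈-sym (T.coeff-∷ a (φ μ) _ w)) ⟩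
    T.termCoeff (coeff p ν) (φ ν) w + T.coeff ((a , φ μ) ∷ mapMonomials (without ν p)) w ∎
    where rest = T.coeff (mapMonomials (without ν p)) w

  without-head : ∀ a ν p → without ν ((a , ν) ∷ p) ≡ without ν p
  without-head a ν p = filter-reject (λ t → ¬? (proj₂ t ≟M ν)) (λ ν≢ν → ν≢ν refl)

  without-resp-≈ₚ : ∀ ν {p p′} → p ≈ₚ p′ → without ν p ≈ₚ without ν p′
  without-resp-≈ₚ ν {p} {p′} p≈p′ μ with ν ≟M μ
  ... | yes refl = ≈-trans (coeff-without-self ν p) (≈-sym (coeff-without-self ν p′))
  ... | no ν≢μ   =
    ≈-trans (coeff-without-other p ν≢μ) (≈-trans (p≈p′ μ) (≈-sym (coeff-without-other p′ ν≢μ)))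

  -- induction on the total number of terms; each step removes one monomial from both sides
  mapMonomials-resp-≈ₚ : ∀ {p p′} → p ≈ₚ p′ → mapMonomials p T.≈ₚ mapMonomials p′
  mapMonomials-resp-≈ₚ {p} {p′} = go _ p p′ ≤-refl
    where
    go : ∀ n p p′ → List.length p ℕ.+ List.length p′ ℕ.≤ n →
      p ≈ₚ p′ → mapMonomials p T.≈ₚ mapMonomials p′
    remove : ∀ n ν p p′ → List.length (without ν p) ℕ.+ List.length (without ν p′) ℕ.≤ n →
      p ≈ₚ p′ → mapMonomials p T.≈ₚ mapMonomials p′
    remove n ν p p′ len p≈p′ w = begin
      T.coeff (mapMonomials p) w
        ≈⟨ coeff-mapMonomials-split ν p w ⟩
      T.termCoeff (coeff p ν) (φ ν) w + T.coeff (mapMonomials (without ν p)) w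
        ≈⟨ +-cong (T.termCoeff-cong (φ ν) w (p≈p′ ν))
                  (go n (without ν p) (without ν p′) len (without-resp-≈ₚ ν {p} {p′} p≈p′) w) ⟩
      T.termCoeff (coeff p′ ν) (φ ν) w + T.coeff (mapMonomials (without ν p′)) w
        ≈⟨ ≈-sym (coeff-mapMonomials-split ν p′ w) ⟩
      T.coeff (mapMonomials p′) w ∎
    go n       []            []             _           _    _ = ≈-refl
    go (suc n) ((a , ν) ∷ p) p′             (ℕ.s≤s len) p≈p′ =
      remove n ν ((a , ν) ∷ p) p′ (subst (λ q → List.length q ℕ.+ _ ℕ.≤ n) (sym (without-head a ν p))
        (≤-trans (+-mono-≤ (length-filter _ p) (length-filter _ p′)) len)) p≈p′
    go (suc n) []            ((a , ν) ∷ p′) (ℕ.s≤s len) p≈p′ =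
      remove n ν [] ((a , ν) ∷ p′) (subst (λ q → List.length q ℕ.≤ n) (sym (without-head a ν p′))
        (≤-trans (length-filter _ p′) len)) p≈p′

  mapMonomials-++ : ∀ p q → mapMonomials (p ++ q) ≡ mapMonomials p ++ mapMonomials q
  mapMonomials-++ p q = map-++ _ p q
    where open import Data.List.Properties using (map-++)

  mapMonomials-*-binomial : ∀ g t u → (∀ μ → φ (μ · t) ≡ φ (μ · u)) →
    mapMonomials (g *ₚ binomial t u) T.≈ₚ []
  mapMonomials-*-binomial []            t u φt≡φu w = ≈-refl
  mapMonomials-*-binomial ((a , μ) ∷ g) t u φt≡φu w = begin
    T.coeff ((a * 1# , φ (μ · t)) ∷ (a * - 1# , φ (μ · u)) ∷ rest) w
      ≈⟨ T.coeff-∷ _ _ _ w ⟩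
    T.termCoeff (a * 1#) (φ (μ · t)) w + T.coeff ((a * - 1# , φ (μ · u)) ∷ rest) w
      ≈⟨ +-congˡ (T.coeff-∷ _ _ _ w) ⟩
    T.termCoeff (a * 1#) (φ (μ · t)) w + (T.termCoeff (a * - 1#) (φ (μ · u)) w + T.coeff rest w)
      ≈⟨ ≈-sym (+-assoc _ _ _) ⟩
    (T.termCoeff (a * 1#) (φ (μ · t)) w + T.termCoeff (a * - 1#) (φ (μ · u)) w) + T.coeff rest w
      ≈⟨ +-congʳ (≈-trans (+-congˡ (reflexive (cong (λ ν → T.termCoeff (a * - 1#) ν w) (sym (φt≡φu μ)))))
                          (T.termCoeff-+ _ _ (φ (μ · t)) w)) ⟩
    T.termCoeff (a * 1# + a * - 1#) (φ (μ · t)) w + T.coeff rest w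
      ≈⟨ +-cong (≈-trans (T.termCoeff-cong (φ (μ · t)) w a-a≈0) (T.termCoeff-zero _ w))
                (mapMonomials-*-binomial g t u φt≡φu w) ⟩
    0# + 0#
      ≈⟨ +-identityˡ 0# ⟩
    0# ∎
    where
    rest = mapMonomials (g *ₚ binomial t u)
    a-a≈0 : a * 1# + a * - 1# ≈ 0#
    a-a≈0 = ≈-trans (≈-sym (distribˡ a 1# (- 1#))) (≈-trans (*-congˡ (-‿inverseʳ 1#)) (zeroʳ a))

  Combination-in-kernel : ∀ {P S h} → (∀ t u → S t u → ∀ μ → φ (μ · t) ≡ φ (μ · u)) →
    Combination P S h → mapMonomials h T.≈ₚ []
  Combination-in-kernel S⊆ker none = λ _ → ≈-refl
  Combination-in-kernel S⊆ker (add {h} g t u _ Stu c) w rewrite mapMonomials-++ (g *ₚ binomial t u) h =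
    ≈-trans (T.coeff-++ (mapMonomials (g *ₚ binomial t u)) (mapMonomials h) w)
      (≈-trans (+-cong (mapMonomials-*-binomial g t u (S⊆ker t u Stu) w) (Combination-in-kernel S⊆ker c w))
               (+-identityˡ 0#))

module MonomialMapKernel {c ℓ} (R : CommutativeRing c ℓ)
                         {M : Set} (_≟M_ : DecidableEquality M) (_·_ : M → M → M)
                         {N : Set} (_≟N_ : DecidableEquality N) (_∙_ : N → N → N)
                         (φ : M → N) where
  open CommutativeRing R renaming (refl to ≈-refl; sym to ≈-sym; trans to ≈-trans)
  open import Relation.Binary.Reasoning.Setoid setoid
  open import Algebra.Properties.CommutativeSemigroup +-commutativeSemigroup using (interchange)
  open import Data.List.Properties using (map-∘)
  open Poly R _≟M_ _·_
  open PolyProperties R _≟M_ _·_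
  open MonomialMap R _≟M_ _·_ _≟N_ _∙_ φ

  monomials : Polynomial → List M
  monomials = List.map proj₂

  fiberRep : M → Polynomial → N → M
  fiberRep d []            w = d
  fiberRep d ((b , ν) ∷ p) w with φ ν ≟N w
  ... | yes _ = ν
  ... | no  _ = fiberRep d p w

  fiberRep-∈ : ∀ d p {μ} → μ ∈ monomials p →
    fiberRep d p (φ μ) ∈ monomials p × φ (fiberRep d p (φ μ)) ≡ φ μ
  fiberRep-∈ d ((b , ν) ∷ p) {μ} μ∈p with φ ν ≟N φ μ
  ... | yes φν≡φμ = Any.here refl , φν≡φμ
  ... | no  φν≢φμ with μ∈p
  ...   | Any.here refl = ⊥-elim (φν≢φμ refl)
  ...   | Any.there μ∈p′ = let (r∈p , φr≡φμ) = fiberRep-∈ d p μ∈p′ in Any.there r∈p , φr≡φμ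

  differences : (M → M) → Polynomial → Polynomial
  differences r []            = []
  differences r ((b , μ) ∷ q) = (b , μ) ∷ (- b , r μ) ∷ differences r q

  differences-binomialSum : ∀ {S} r q → (∀ {μ} → μ ∈ monomials q → S μ (r μ)) →
    BinomialSum S (differences r q)
  differences-binomialSum r []            _  = []
  differences-binomialSum r ((b , μ) ∷ q) Sr =
    cons b (Sr (Any.here refl)) (differences-binomialSum r q (Sr ∘ Any.there))

  split-differences : ∀ r q → q ≈ₚ (differences r q ++ List.map (λ t → proj₁ t , r (proj₂ t)) q)
  split-differences r []            λ′ = ≈-refl
  split-differences r ((b , μ) ∷ q) λ′ = ≈-sym (begin
    coeff ((b , μ) ∷ (- b , r μ) ∷ (D ++ (b , r μ) ∷ Rq)) λ′
      ≈⟨ coeff-∷ b μ _ λ′ ⟩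
    X + coeff ((- b , r μ) ∷ (D ++ (b , r μ) ∷ Rq)) λ′
      ≈⟨ +-congˡ (≈-trans (coeff-∷ (- b) (r μ) _ λ′) (+-congˡ (coeff-++ D _ λ′))) ⟩
    X + (Y + (coeff D λ′ + coeff ((b , r μ) ∷ Rq) λ′))
      ≈⟨ +-congˡ (+-congˡ (+-congˡ (coeff-∷ b (r μ) Rq λ′))) ⟩
    X + (Y + (coeff D λ′ + (Y′ + coeff Rq λ′)))
      ≈⟨ +-congˡ (≈-trans (≈-sym (+-assoc _ _ _)) (interchange _ _ _ _)) ⟩
    X + ((Y + Y′) + (coeff D λ′ + coeff Rq λ′))
      ≈⟨ +-congˡ (≈-trans (+-congʳ (≈-trans (+-comm _ _) (termCoeff-inverseʳ b (r μ) λ′))) (+-identityˡ _)) ⟩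
    X + (coeff D λ′ + coeff Rq λ′)
      ≈⟨ +-congˡ (≈-trans (≈-sym (coeff-++ D Rq λ′)) (≈-sym (split-differences r q λ′))) ⟩
    X + coeff q λ′
      ≈⟨ ≈-sym (coeff-∷ b μ q λ′) ⟩
    coeff ((b , μ) ∷ q) λ′ ∎)
    where
    D  = differences r q
    Rq = List.map (λ t → proj₁ t , r (proj₂ t)) q
    X  = termCoeff b μ λ′
    Y  = termCoeff (- b) (r μ) λ′
    Y′ = termCoeff b (r μ) λ′

  Fibred : Polynomial → M → M → Set
  Fibred p μ ν = μ ∈ monomials p × ν ∈ monomials p × φ μ ≡ φ ν

  -- Replacing each monomial by the representative of its fibre is a monomial
  -- map factoring through φ, so it kills the kernel: only differences remain.
  kernel-binomialSum : ∀ p → mapMonomials p T.≈ₚ [] → ∃ λ h → BinomialSum (Fibred p) h × p ≈ₚ h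
  kernel-binomialSum []                  _      = [] , [] , λ _ → ≈-refl
  kernel-binomialSum p@((_ , d) ∷ _) p∈ker =
    differences r p ,
    differences-binomialSum r p (λ μ∈p → μ∈p , fiberRep-∈ d p μ∈p .proj₁ , sym (fiberRep-∈ d p μ∈p .proj₂)) ,
    λ λ′ → ≈-trans (split-differences r p λ′) (≈-trans (coeff-++ (differences r p) _ λ′)
             (≈-trans (+-congˡ (representatives≈0 λ′)) (+-identityʳ _)))
    where
    rep = fiberRep d p
    r   = rep ∘ φ
    module Rep = MonomialMap R _≟N_ _∙_ _≟M_ _·_ rep
    representatives≈0 : ∀ λ′ → coeff (List.map (λ t → proj₁ t , r (proj₂ t)) p) λ′ ≈ 0#
    representatives≈0 λ′ = ≈-trans
      (reflexive (cong (λ q → coeff q λ′)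
        (map-∘ {g = λ t → proj₁ t , rep (proj₂ t)} {f = λ t → proj₁ t , φ (proj₂ t)} p)))
      (Rep.mapMonomials-resp-≈ₚ {mapMonomials p} {[]} p∈ker λ′)

module _ where
  open import Data.List.Relation.Unary.Unique.Propositional using (Unique; []; _∷_)
  import Data.List.Relation.Unary.Unique.Propositional.Properties as Unique
  import Data.List.Relation.Unary.All as All
  import Data.List.Relation.Unary.All.Properties as All
  open import Data.List.Membership.Propositional using (_∉_)
  open import Data.List.Membership.Propositional.Properties using (∈-++⁺ʳ)

  Unique-++⁻ : ∀ {A : Set} (xs : List A) {ys} → Unique (xs ++ ys) →
    Unique xs × Unique ys × (∀ {z} → z ∈ xs → z ∉ ys)
  Unique-++⁻ []       u          = [] , u , λ ()
  Unique-++⁻ (x ∷ xs) (x∉ ∷ u) with Unique-++⁻ xs u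
  ... | uxs , uys , disjoint =
    All.++⁻ˡ xs x∉ ∷ uxs , uys ,
    λ { (Any.here refl) z∈ys → All.lookup x∉ (∈-++⁺ʳ xs z∈ys) refl ; (Any.there z∈xs) → disjoint z∈xs }

  Unique-++-comm : ∀ {A : Set} (xs ys : List A) → Unique (xs ++ ys) → Unique (ys ++ xs)
  Unique-++-comm xs ys u with Unique-++⁻ xs u
  ... | uxs , uys , disjoint = Unique.++⁺ uys uxs λ (z∈ys , z∈xs) → disjoint z∈xs z∈ys

-- Walks

module Walks {n m} (G : Graph n m) where
  open import Data.Nat using (_+_; parity)
  open import Data.Bool using (not)
  open import Data.Bool.Properties using (¬-not; not-involutive)
  open import Data.Parity using (Parity; 0ℙ; 1ℙ; _⁻¹)
  open import Data.Parity.Properties using (+-homo-+)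
  open import Relation.Binary.PropositionalEquality using (≢-sym)
  open import Data.List.Membership.Propositional.Properties using (∈-++⁺ˡ; ∈-++⁺ʳ; ∈-++⁻)

  infixr 5 _++ʷ_
  _++ʷ_ : ∀ {a b c} → Walk G a b → Walk G b c → Walk G a c
  []           ++ʷ q = q
  step f j p   ++ʷ q = step f j (p ++ʷ q)

  ++ʷ-identityʳ : ∀ {a b} (p : Walk G a b) → p ++ʷ [] ≡ p
  ++ʷ-identityʳ []           = refl
  ++ʷ-identityʳ (step f j p) = cong (step f j) (++ʷ-identityʳ p)

  verts-cycleVerts : ∀ {a b} (p : Walk G a b) → verts G p ≡ a ∷ cycleVerts G p
  verts-cycleVerts []           = refl
  verts-cycleVerts (step f j p) = refl

  verts-++ʷ : ∀ {a b c} (p : Walk G a b) (q : Walk G b c) →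
    verts G (p ++ʷ q) ≡ verts G p ++ cycleVerts G q
  verts-++ʷ []             q = verts-cycleVerts q
  verts-++ʷ {a} (step f j p) q = cong (a ∷_) (verts-++ʷ p q)

  cycleVerts-++ʷ : ∀ {a b c} (p : Walk G a b) (q : Walk G b c) →
    cycleVerts G (p ++ʷ q) ≡ cycleVerts G p ++ cycleVerts G q
  cycleVerts-++ʷ []           q = refl
  cycleVerts-++ʷ (step f j p) q = verts-++ʷ p q

  edges-++ʷ : ∀ {a b c} (p : Walk G a b) (q : Walk G b c) → edges G (p ++ʷ q) ≡ edges G p ++ edges G q
  edges-++ʷ []           q = refl
  edges-++ʷ (step f j p) q = cong (f ∷_) (edges-++ʷ p q)

  len-++ʷ : ∀ {a b c} (p : Walk G a b) (q : Walk G b c) → len G (p ++ʷ q) ≡ len G p + len G q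
  len-++ʷ []           q = refl
  len-++ʷ (step f j p) q = cong suc (len-++ʷ p q)

  ∈-edges-++ʷ⁻ : ∀ {a b c f} (p : Walk G a b) (q : Walk G b c) →
    f ∈ edges G (p ++ʷ q) → f ∈ edges G p ⊎ f ∈ edges G q
  ∈-edges-++ʷ⁻ p q f∈ = ∈-++⁻ (edges G p) (subst (_ ∈_) (edges-++ʷ p q) f∈)

  ∈-edges-++ʷ-comm : ∀ {a b f} (p : Walk G a b) (q : Walk G b a) →
    f ∈ edges G (p ++ʷ q) → f ∈ edges G (q ++ʷ p)
  ∈-edges-++ʷ-comm p q f∈ = subst (_ ∈_) (sym (edges-++ʷ q p)) (swap (∈-edges-++ʷ⁻ p q f∈))
    where
    swap : _ → _
    swap (inj₁ f∈p) = ∈-++⁺ʳ (edges G q) f∈p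
    swap (inj₂ f∈q) = ∈-++⁺ˡ f∈q

  last∈verts : ∀ {a b} (p : Walk G a b) → b ∈ verts G p
  last∈verts []           = Any.here refl
  last∈verts (step f j p) = Any.there (last∈verts p)

  Joins-sym : ∀ {f x y} → Joins G f x y → Joins G f y x
  Joins-sym (inj₁ (s , t)) = inj₂ (s , t)
  Joins-sym (inj₂ (s , t)) = inj₁ (s , t)

  Joins-end : ∀ {f x y a b} → Joins G f x y → Joins G f a b → x ≡ a ⊎ x ≡ b
  Joins-end (inj₁ (s , _)) (inj₁ (s′ , _)) = inj₁ (trans (sym s) s′)
  Joins-end (inj₁ (s , _)) (inj₂ (s′ , _)) = inj₂ (trans (sym s) s′)
  Joins-end (inj₂ (_ , t)) (inj₁ (_ , t′)) = inj₂ (trans (sym t) t′)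
  Joins-end (inj₂ (_ , t)) (inj₂ (_ , t′)) = inj₁ (trans (sym t) t′)

  toggle : Parity → Bool → Bool
  toggle 0ℙ x = x
  toggle 1ℙ x = not x

  colour-along : (col : Fin n → Bool) {Proper : Fin m → Set} →
    (∀ f x y → Joins G f x y → Proper f → col x ≢ col y) →
    ∀ {a b} (p : Walk G a b) → (∀ f → f ∈ edges G p → Proper f) → col b ≡ toggle (parity (len G p)) (col a)
  colour-along col proper []           _   = refl
  colour-along col proper {a} (step {y = y} f j q) ok rewrite +-homo-+ 1 (len G q) =
    trans (colour-along col proper q (λ f′ f′∈q → ok f′ (Any.there f′∈q)))
      (trans (cong (toggle (parity (len G q))) (¬-not (≢-sym (proper f a y j (ok f (Any.here refl))))))
             (toggle-not (parity (len G q)) (col a)))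
    where
    toggle-not : ∀ π x → toggle π (not x) ≡ toggle (π ⁻¹) x
    toggle-not 0ℙ x = refl
    toggle-not 1ℙ x = not-involutive x

  odd-if-colours-differ : (col : Fin n → Bool) {Proper : Fin m → Set} →
    (∀ f x y → Joins G f x y → Proper f → col x ≢ col y) →
    ∀ {a b} (p : Walk G a b) → (∀ f → f ∈ edges G p → Proper f) → col a ≢ col b → parity (len G p) ≡ 1ℙ
  odd-if-colours-differ col proper p ok a≢b with parity (len G p) | colour-along col proper p ok
  ... | 0ℙ | b≡a = ⊥-elim (a≢b (sym b≡a))
  ... | 1ℙ | _   = refl

module GraphMonomials {n m} (G : Graph n m) where
  open import Data.Nat using (_≤_; parity)
  open import Data.Nat.Properties using (≤-trans; ≤-reflexive; *-identityʳ; *-monoʳ-≤; m≤m+n)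
  open import Data.Parity using (Parity; 0ℙ; 1ℙ)
  open import Data.Parity.Properties using (+-homo-+)
  open Graph G using (src; tgt)
  open Walks G

  edgeEnds : Fin m → Vec ℕ n
  edgeEnds f = unitV (src f) ⊕ unitV (tgt f)

  ψE : Vec ℕ m → Vec ℕ n
  ψE = linComb edgeEnds

  ψE-unit : ∀ {f x y} → Joins G f x y → ψE (unitE G f) ≡ unitV x ⊕ unitV y
  ψE-unit {f} j = trans (linComb-unit edgeEnds f) (ends j)
    where
    ends : ∀ {x y} → Joins G f x y → edgeEnds f ≡ unitV x ⊕ unitV y
    ends (inj₁ (refl , refl)) = refl
    ends (inj₂ (refl , refl)) = ⊕-comm _ _

  ψE-bound : ∀ a f → lookup a f ≤ lookup (ψE a) (src f)
  ψE-bound a f = ≤-trans (≤-reflexive (sym (*-identityʳ _)))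
    (≤-trans (*-monoʳ-≤ (lookup a f) src∈f) (linComb-≥ edgeEnds a f (src f)))
    where
    src∈f : 1 ≤ lookup (edgeEnds f) (src f)
    src∈f = ≤-trans (≤-reflexive (sym (lookup-unitV-self (src f))))
      (≤-trans (m≤m+n _ _) (≤-reflexive (sym (lookup-⊕ (unitV (src f)) _ (src f)))))

  tailMono : ∀ {a b} → Walk G a b → Vec ℕ n
  tailMono p = sumV (List.map unitV (cycleVerts G p))

  tailMono-step : ∀ {a y b f} (j : Joins G f a y) (q : Walk G y b) → tailMono (step f j q) ≡ unitV y ⊕ tailMono q
  tailMono-step j q = cong (sumV ∘ List.map unitV) (verts-cycleVerts q)

  tailMono-++ʷ : ∀ {a b c} (p : Walk G a b) (q : Walk G b c) → tailMono (p ++ʷ q) ≡ tailMono p ⊕ tailMono q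
  tailMono-++ʷ p q = trans (cong (sumV ∘ List.map unitV) (cycleVerts-++ʷ p q))
    (sumV-map-++ (cycleVerts G p) (cycleVerts G q))
    where
    sumV-map-++ : ∀ xs ys → sumV (List.map unitV (xs ++ ys)) ≡ sumV (List.map unitV xs) ⊕ sumV (List.map unitV ys)
    sumV-map-++ []       ys = sym (⊕-identityˡ _)
    sumV-map-++ (x ∷ xs) ys = trans (cong (unitV x ⊕_) (sumV-map-++ xs ys)) (sym (⊕-assoc (unitV x) _ _))

  AltImage : Parity → Fin n → Fin n → Vec ℕ m × Vec ℕ m → Vec ℕ n → Set
  AltImage 0ℙ a b (odds , evens) t = (ψE odds ⊕ unitV b ≡ unitV a ⊕ t) × (ψE evens ≡ t)
  AltImage 1ℙ a b (odds , evens) t = (ψE odds ≡ unitV a ⊕ t) × (ψE evens ⊕ unitV b ≡ t)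

  alt-image : ∀ {a b} (p : Walk G a b) → AltImage (parity (len G p)) a b (alt G p) (tailMono p)
  alt-image {a} []  = trans (cong (_⊕ unitV a) (linComb-zero edgeEnds)) (⊕-comm zeroV (unitV a)) ,
                      linComb-zero edgeEnds
  alt-image {a} {b} (step {y = y} f j q) rewrite +-homo-+ 1 (len G q) with parity (len G q) | alt-image q
  ... | 0ℙ | (odds , evens) = odds′ , trans odds (sym (tailMono-step j q))
    where
    open ≡-Reasoning
    odds′ : ψE (unitE G f ⊕ proj₂ (alt G q)) ≡ unitV a ⊕ tailMono (step f j q)
    odds′ = begin
      ψE (unitE G f ⊕ proj₂ (alt G q))          ≡⟨ linComb-⊕ edgeEnds (unitE G f) _ ⟩
      ψE (unitE G f) ⊕ ψE (proj₂ (alt G q))     ≡⟨ cong₂ _⊕_ (ψE-unit j) evens ⟩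
      (unitV a ⊕ unitV y) ⊕ tailMono q          ≡⟨ ⊕-assoc _ _ _ ⟩
      unitV a ⊕ (unitV y ⊕ tailMono q)          ≡⟨ cong (unitV a ⊕_) (sym (tailMono-step j q)) ⟩
      unitV a ⊕ tailMono (step f j q)           ∎
  ... | 1ℙ | (odds , evens) = odds′ , trans odds (sym (tailMono-step j q))
    where
    open ≡-Reasoning
    odds′ : ψE (unitE G f ⊕ proj₂ (alt G q)) ⊕ unitV b ≡ unitV a ⊕ tailMono (step f j q)
    odds′ = begin
      ψE (unitE G f ⊕ proj₂ (alt G q)) ⊕ unitV b           ≡⟨ cong (_⊕ unitV b) (linComb-⊕ edgeEnds (unitE G f) _) ⟩
      (ψE (unitE G f) ⊕ ψE (proj₂ (alt G q))) ⊕ unitV b    ≡⟨ ⊕-assoc _ _ _ ⟩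
      ψE (unitE G f) ⊕ (ψE (proj₂ (alt G q)) ⊕ unitV b)    ≡⟨ cong₂ _⊕_ (ψE-unit j) evens ⟩
      (unitV a ⊕ unitV y) ⊕ tailMono q                     ≡⟨ ⊕-assoc _ _ _ ⟩
      unitV a ⊕ (unitV y ⊕ tailMono q)                     ≡⟨ cong (unitV a ⊕_) (sym (tailMono-step j q)) ⟩
      unitV a ⊕ tailMono (step f j q)                      ∎

  closed-even-alt-image : ∀ {x} (w : Walk G x x) → parity (len G w) ≡ 0ℙ →
    ψE (proj₁ (alt G w)) ≡ tailMono w × ψE (proj₂ (alt G w)) ≡ tailMono w
  closed-even-alt-image {x} w even with parity (len G w) | alt-image w
  ... | 0ℙ | (odds , evens) = ⊕-cancelʳ _ _ (unitV x) (trans odds (⊕-comm _ _)) , evens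

  odd-alt-image : ∀ {a b} (p : Walk G a b) → parity (len G p) ≡ 1ℙ → ψE (proj₂ (alt G p)) ⊕ unitV b ≡ tailMono p
  odd-alt-image p odd with parity (len G p) | alt-image p
  ... | 1ℙ | (_ , evens) = evens

-- Cycles through a separating face

module SeparatingFace {n m} (G : Graph n m) (simple : IsSimple G)
                      (e : Fin m) (u v : Fin n) (e-joins : Joins G e u v)
                      (side : Fin n → Bool) (split : Decomposition.IsSplit G e u v side) where
  open import Data.Nat using (_+_; parity)
  open import Data.Nat.Properties using (+-comm; m+1+n≢0)
  open import Data.Parity as ℙ using (0ℙ; 1ℙ; _⁻¹)
  open import Data.Parity.Properties using (+-homo-+; ⁻¹-selfInverse)
  open import Data.Unit using (⊤; tt)
  open import Data.List.Relation.Unary.Unique.Propositional using (Unique; _∷_)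
  open import Data.List.Relation.Unary.Unique.Propositional.Properties using (Unique[x∷xs]⇒x∉xs)
  open import Data.List.Membership.Propositional using (_∉_)
  open import Relation.Nullary.Decidable using (_⊎-dec_)
  open IsSimple simple
  open Decomposition G e u v side
  open Walks G
  open GraphMonomials G using (edgeEnds; ψE; ψE-unit; tailMono; tailMono-++ʷ; odd-alt-image)

  UV : Fin n → Set
  UV z = z ≡ u ⊎ z ≡ v

  UV? : ∀ z → Dec (UV z)
  UV? z = z Fin.≟ u ⊎-dec z Fin.≟ v

  uv-pair : ∀ {a b} → UV a → UV b → a ≢ b → (a ≡ u × b ≡ v) ⊎ (a ≡ v × b ≡ u)
  uv-pair (inj₁ refl) (inj₁ refl) a≢b = ⊥-elim (a≢b refl)
  uv-pair (inj₁ a≡u)  (inj₂ b≡v)  _   = inj₁ (a≡u , b≡v)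
  uv-pair (inj₂ a≡v)  (inj₁ b≡u)  _   = inj₂ (a≡v , b≡u)
  uv-pair (inj₂ refl) (inj₂ refl) a≢b = ⊥-elim (a≢b refl)

  uv-third : ∀ {a b z} → UV a → UV b → a ≢ b → UV z → z ≡ a ⊎ z ≡ b
  uv-third a∈ b∈ a≢b z∈ with uv-pair a∈ b∈ a≢b | z∈
  ... | inj₁ (refl , refl) | inj₁ z≡u = inj₁ z≡u
  ... | inj₁ (refl , refl) | inj₂ z≡v = inj₂ z≡v
  ... | inj₂ (refl , refl) | inj₁ z≡u = inj₂ z≡u
  ... | inj₂ (refl , refl) | inj₂ z≡v = inj₁ z≡v

  uv-edge : ∀ {f a b} → UV a → UV b → a ≢ b → Joins G f a b → f ≡ e
  uv-edge a∈ b∈ a≢b j with uv-pair a∈ b∈ a≢b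
  ... | inj₁ (refl , refl) = noMulti _ e u v j e-joins
  ... | inj₂ (refl , refl) = noMulti _ e u v (Joins-sym j) e-joins

  no-loop : ∀ {f a} → ¬ Joins G f a a
  no-loop {f} (inj₁ (s , t)) = loopless f (trans s (sym t))
  no-loop {f} (inj₂ (s , t)) = loopless f (trans s (sym t))

  off-end⇒≢e : ∀ {f x y} → Joins G f x y → OffUV x → f ≢ e
  off-end⇒≢e j x-off refl with Joins-end j e-joins
  ... | inj₁ x≡u = x-off (inj₁ x≡u)
  ... | inj₂ x≡v = x-off (inj₂ x≡v)

  off-edge-in-piece : ∀ {f x y} → Joins G f x y → OffUV x → InPieceMinusE (side x) f
  off-edge-in-piece j x-off = off-end⇒≢e j x-off , _ , (_ , j) , x-off , refl

  InPieceMinusE-unique : ∀ {σ τ f} → InPieceMinusE σ f → InPieceMinusE τ f → σ ≡ τ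
  InPieceMinusE-unique (_ , x , (y , j) , x-off , refl) (_ , x′ , (_ , j′) , x′-off , refl)
    with Joins-end j′ j
  ... | inj₁ refl = refl
  ... | inj₂ refl = split _ x x′ j x-off x′-off

  G₁≢G₂ : ∀ {f} → InPieceMinusE false f → ¬ InPieceMinusE true f
  G₁≢G₂ f∈G₁ f∈G₂ with InPieceMinusE-unique f∈G₁ f∈G₂
  ... | ()

  OffUntilLast : ∀ {a b} → Walk G a b → Set
  OffUntilLast []                 = ⊤
  OffUntilLast (step {x} f j q) = OffUV x × OffUntilLast q

  off-walk-in-piece : ∀ {x b} (p : Walk G x b) → OffUntilLast p →
    ∀ f → f ∈ edges G p → InPieceMinusE (side x) f
  off-walk-in-piece (step f j q) (x-off , _) _ (Any.here refl) = off-edge-in-piece j x-off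
  off-walk-in-piece (step {x} {y} f j q@(step _ _ _)) (x-off , q-off@(y-off , _)) f′ (Any.there f′∈q) =
    subst (λ σ → InPieceMinusE σ f′) (sym (split f x y j x-off y-off)) (off-walk-in-piece q q-off f′ f′∈q)

  Segment : ∀ {a b} → Walk G a b → Set
  Segment []           = ⊥
  Segment (step f j q) = OffUntilLast q

  segment-within-piece : ∀ {a b σ f} → UV a → UV b → (S : Walk G a b) → Segment S →
    f ∈ edges G S → InPieceMinusE σ f → ∀ f′ → f′ ∈ edges G S → InPieceMinusE σ f′
  segment-within-piece {a} {b} a∈ b∈ (step f j []) _ (Any.here refl) (f≢e , _) _ (Any.here refl)
    with a Fin.≟ b
  ... | yes refl = ⊥-elim (no-loop j)
  ... | no  a≢b  = ⊥-elim (f≢e (uv-edge a∈ b∈ a≢b j))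
  segment-within-piece a∈ b∈ (step {y = y} f j q@(step _ _ _)) q-off@(y-off , _) f∈S f∈σ f′ f′∈S =
    subst (λ τ → InPieceMinusE τ f′) (InPieceMinusE-unique (S-in-piece _ f∈S) f∈σ) (S-in-piece f′ f′∈S)
    where
    S-in-piece : ∀ f′ → f′ ∈ edges G (step f j q) → InPieceMinusE (side y) f′
    S-in-piece _ (Any.here refl)   = off-edge-in-piece (Joins-sym j) y-off
    S-in-piece f′ (Any.there f′∈q) = off-walk-in-piece q q-off f′ f′∈q

  FirstHit : ∀ {a b} → Walk G a b → Set
  FirstHit {a} {b} p = ∃ λ c → UV c × Σ (Walk G a c) λ p₁ → Σ (Walk G c b) λ p₂ →
    p ≡ p₁ ++ʷ p₂ × OffUntilLast p₁

  firstHit : ∀ {a b} (p : Walk G a b) → (OffUntilLast p × OffUV b) ⊎ FirstHit p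
  firstHit {a} [] with UV? a
  ... | yes a∈ = inj₂ (a , a∈ , [] , [] , refl , tt)
  ... | no  a∉ = inj₁ (tt , a∉)
  firstHit {a} (step f j q) with UV? a
  ... | yes a∈ = inj₂ (a , a∈ , [] , step f j q , refl , tt)
  ... | no  a∉ with firstHit q
  ...   | inj₁ (q-off , b-off) = inj₁ ((a∉ , q-off) , b-off)
  ...   | inj₂ (c , c∈ , p₁ , p₂ , refl , p₁-off) = inj₂ (c , c∈ , step f j p₁ , p₂ , refl , a∉ , p₁-off)

  record TwoSegments {x} (w : Walk G x x) : Set where
    field
      {a b}           : Fin n
      ends            : (a ≡ u × b ≡ v) ⊎ (a ≡ v × b ≡ u)
      A               : Walk G a b
      B               : Walk G b a
      A-in-G₂         : ∀ f → f ∈ edges G A → InPieceMinusE true f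
      B-in-G₁         : ∀ f → f ∈ edges G B → InPieceMinusE false f
      tailMono-split  : tailMono w ≡ tailMono A ⊕ tailMono B
      len-split       : len G w ≡ len G A + len G B
      edges-split     : ∀ f → f ∈ edges G w → f ∈ edges G A ⊎ f ∈ edges G B

  twoSegments-rotate : ∀ {x a} (p : Walk G x a) (q : Walk G a x) → TwoSegments (q ++ʷ p) → TwoSegments (p ++ʷ q)
  twoSegments-rotate p q T = record
    { ends = ends ; A = A ; B = B ; A-in-G₂ = A-in-G₂ ; B-in-G₁ = B-in-G₁
    ; tailMono-split = trans (tailMono-++ʷ p q) (trans (⊕-comm _ _) (trans (sym (tailMono-++ʷ q p)) tailMono-split))
    ; len-split      = trans (len-++ʷ p q) (trans (+-comm (len G p) _) (trans (sym (len-++ʷ q p)) len-split))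
    ; edges-split    = λ f f∈ → edges-split f (∈-edges-++ʷ-comm p q f∈)
    }
    where open TwoSegments T

  segments⇒twoSegments : ∀ {a b g₁ g₂} → UV a → UV b → a ≢ b →
    (S₁ : Walk G a b) → Segment S₁ → (S₂ : Walk G b a) → Segment S₂ →
    g₁ ∈ edges G (S₁ ++ʷ S₂) → InPieceMinusE false g₁ →
    g₂ ∈ edges G (S₁ ++ʷ S₂) → InPieceMinusE true g₂ →
    TwoSegments (S₁ ++ʷ S₂)
  segments⇒twoSegments a∈ b∈ a≢b S₁ S₁-seg S₂ S₂-seg g₁∈ g₁∈G₁ g₂∈ g₂∈G₂
    with ∈-edges-++ʷ⁻ S₁ S₂ g₁∈ | ∈-edges-++ʷ⁻ S₁ S₂ g₂∈
  ... | inj₁ g₁∈S₁ | inj₁ g₂∈S₁ =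
    ⊥-elim (G₁≢G₂ (segment-within-piece a∈ b∈ S₁ S₁-seg g₁∈S₁ g₁∈G₁ _ g₂∈S₁) g₂∈G₂)
  ... | inj₂ g₁∈S₂ | inj₂ g₂∈S₂ =
    ⊥-elim (G₁≢G₂ (segment-within-piece b∈ a∈ S₂ S₂-seg g₁∈S₂ g₁∈G₁ _ g₂∈S₂) g₂∈G₂)
  ... | inj₂ g₁∈S₂ | inj₁ g₂∈S₁ = record
    { ends = uv-pair a∈ b∈ a≢b ; A = S₁ ; B = S₂
    ; A-in-G₂ = segment-within-piece a∈ b∈ S₁ S₁-seg g₂∈S₁ g₂∈G₂
    ; B-in-G₁ = segment-within-piece b∈ a∈ S₂ S₂-seg g₁∈S₂ g₁∈G₁
    ; tailMono-split = tailMono-++ʷ S₁ S₂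
    ; len-split = len-++ʷ S₁ S₂
    ; edges-split = λ f → ∈-edges-++ʷ⁻ S₁ S₂
    }
  ... | inj₁ g₁∈S₁ | inj₂ g₂∈S₂ = record
    { ends = uv-pair b∈ a∈ (a≢b ∘ sym) ; A = S₂ ; B = S₁
    ; A-in-G₂ = segment-within-piece b∈ a∈ S₂ S₂-seg g₂∈S₂ g₂∈G₂
    ; B-in-G₁ = segment-within-piece a∈ b∈ S₁ S₁-seg g₁∈S₁ g₁∈G₁
    ; tailMono-split = trans (tailMono-++ʷ S₁ S₂) (⊕-comm _ _)
    ; len-split = trans (len-++ʷ S₁ S₂) (+-comm (len G S₁) _)
    ; edges-split = λ f f∈ → swap (∈-edges-++ʷ⁻ S₁ S₂ f∈)
    }
    where open import Data.Sum using (swap)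

  -- the interior of the second segment avoids u and v because the cycle is simple
  offUntilLast-unique : ∀ {y a b} (r : Walk G y a) → Unique (verts G r) → (∀ {z} → z ∈ verts G r → z ≢ b) →
    UV a → UV b → a ≢ b → OffUntilLast r
  offUntilLast-unique []             _        _   _  _  _   = tt
  offUntilLast-unique (step f j r) (y∉ ∷ u) ≢b a∈ b∈ a≢b =
    (λ y∈ → [ (λ { refl → Unique[x∷xs]⇒x∉xs (y∉ ∷ u) (last∈verts r) }) , ≢b (Any.here refl) ]′
               (uv-third a∈ b∈ a≢b y∈)) ,
    offUntilLast-unique r u (≢b ∘ Any.there) a∈ b∈ a≢b
    where open import Data.Sum using ([_,_]′)

  cycle-at-uv⇒twoSegments : ∀ {a g₁ g₂} → UV a → (W : Walk G a a) → Unique (cycleVerts G W) →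
    g₁ ∈ edges G W → InPieceMinusE false g₁ → g₂ ∈ edges G W → InPieceMinusE true g₂ → TwoSegments W
  cycle-at-uv⇒twoSegments a∈ (step f j q) uniq g₁∈ g₁∈G₁ g₂∈ g₂∈G₂ with firstHit q
  ... | inj₁ (_ , a-off) = ⊥-elim (a-off a∈)
  ... | inj₂ (b , b∈ , q₁ , [] , refl , q₁-off) =
    ⊥-elim (G₁≢G₂ (segment-within-piece a∈ b∈ S q₁-off (tidy g₁∈) g₁∈G₁ _ (tidy g₂∈)) g₂∈G₂)
    where
    S = step f j q₁
    tidy : ∀ {g} → g ∈ edges G (step f j (q₁ ++ʷ [])) → g ∈ edges G S
    tidy = subst (λ r → _ ∈ edges G (step f j r)) (++ʷ-identityʳ q₁)
  ... | inj₂ (b , b∈ , q₁ , step f′ j′ q₂ , refl , q₁-off)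
    with Unique-++⁻ (verts G q₁) (subst Unique (verts-++ʷ q₁ (step f′ j′ q₂)) uniq)
  ...   | _ , q₂-unique , disjoint =
    segments⇒twoSegments a∈ b∈ a≢b (step f j q₁) q₁-off (step f′ j′ q₂)
      (offUntilLast-unique q₂ q₂-unique (λ z∈q₂ z≡b → disjoint (subst (_∈ _) (sym z≡b) (last∈verts q₁)) z∈q₂)
        a∈ b∈ a≢b)
      g₁∈ g₁∈G₁ g₂∈ g₂∈G₂
    where
    a≢b : _ ≢ b
    a≢b refl = disjoint (last∈verts q₁) (last∈verts q₂)

  mixed⇒twoSegments : ∀ {x} (w : Walk G x x) → MixedEvenCycle w → TwoSegments w
  mixed⇒twoSegments {x} w ((_ , uniq) , _ , (g₁ , g₁∈ , g₁∈G₁) , (g₂ , g₂∈ , g₂∈G₂)) with firstHit w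
  ... | inj₁ (w-off , _) =
    ⊥-elim (G₁≢G₂ (subst (λ σ → InPieceMinusE σ g₂) (sym side≡) (off-walk-in-piece w w-off g₂ g₂∈))
                  g₂∈G₂)
    where
    side≡ : false ≡ side x
    side≡ = InPieceMinusE-unique g₁∈G₁ (off-walk-in-piece w w-off g₁ g₁∈)
  ... | inj₂ (a , a∈ , r₁ , r₂ , refl , _) =
    twoSegments-rotate r₁ r₂ (cycle-at-uv⇒twoSegments a∈ (r₂ ++ʷ r₁) uniq′
      (∈-edges-++ʷ-comm r₁ r₂ g₁∈) g₁∈G₁ (∈-edges-++ʷ-comm r₁ r₂ g₂∈) g₂∈G₂)
    where
    uniq′ : Unique (cycleVerts G (r₂ ++ʷ r₁))
    uniq′ = subst Unique (sym (cycleVerts-++ʷ r₂ r₁))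
      (Unique-++-comm (cycleVerts G r₁) _ (subst Unique (cycleVerts-++ʷ r₁ r₂) uniq))

  module _ {x} {w : Walk G x x} (T : TwoSegments w) where
    open TwoSegments T

    twoSegments-avoid-e : e ∉ edges G w
    twoSegments-avoid-e e∈w with edges-split e e∈w
    ... | inj₁ e∈A = proj₁ (A-in-G₂ e e∈A) refl
    ... | inj₂ e∈B = proj₁ (B-in-G₁ e e∈B) refl

    -- G⁽²⁾ is bipartite and contains e, so its u–v path A is odd; hence so is B
    twoSegments-odd : PieceBipartite true → parity (len G w) ≡ 0ℙ →
      parity (len G A) ≡ 1ℙ × parity (len G B) ≡ 1ℙ
    twoSegments-odd (col , proper) even = A-odd , sym (⁻¹-selfInverse B⁻¹)
      where
      colours-differ : col a ≢ col b
      colours-differ with ends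
      ... | inj₁ (refl , refl) = proper e u v e-joins (inj₁ refl)
      ... | inj₂ (refl , refl) = proper e u v e-joins (inj₁ refl) ∘ sym
      A-odd : parity (len G A) ≡ 1ℙ
      A-odd = odd-if-colours-differ col proper A (λ f f∈A → inj₂ (A-in-G₂ f f∈A)) colours-differ
      B⁻¹ : parity (len G B) ⁻¹ ≡ 0ℙ
      B⁻¹ = begin
        parity (len G B) ⁻¹                  ≡⟨ cong (ℙ._+ parity (len G B)) (sym A-odd) ⟩
        parity (len G A) ℙ.+ parity (len G B) ≡⟨ sym (+-homo-+ (len G A) (len G B)) ⟩
        parity (len G A + len G B)           ≡⟨ cong parity (sym len-split) ⟩
        parity (len G w)                     ≡⟨ even ⟩
        0ℙ                                   ∎
        where open ≡-Reasoning

    -- the even halves of A and B together with e form a monomial in the fibre of w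
    twoSegments-hub : PieceBipartite true → parity (len G w) ≡ 0ℙ →
      ∃ λ ρ → lookup ρ e ≢ 0 × ψE ρ ≡ tailMono w
    twoSegments-hub bipartite even = ρ , ρₑ≢0 , ψEρ
      where
      evens : ∀ {a b} → Walk G a b → Vec ℕ m
      evens p = proj₂ (alt G p)
      ρ : Vec ℕ m
      ρ = (evens A ⊕ evens B) ⊕ unitE G e
      ρₑ≢0 : lookup ρ e ≢ 0
      ρₑ≢0 ρₑ≡0 = m+1+n≢0 (lookup (evens A ⊕ evens B) e)
        (trans (cong (lookup (evens A ⊕ evens B) e +_) (sym (lookup-unitV-self e)))
               (trans (sym (lookup-⊕ (evens A ⊕ evens B) (unitE G e) e)) ρₑ≡0))
      e-joins-ba : Joins G e b a
      e-joins-ba with ends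
      ... | inj₁ (refl , refl) = Joins-sym e-joins
      ... | inj₂ (refl , refl) = e-joins
      odd : parity (len G A) ≡ 1ℙ × parity (len G B) ≡ 1ℙ
      odd = twoSegments-odd bipartite even
      ψEρ : ψE ρ ≡ tailMono w
      ψEρ = begin
        ψE ((evens A ⊕ evens B) ⊕ unitE G e)
          ≡⟨ linComb-⊕ edgeEnds (evens A ⊕ evens B) (unitE G e) ⟩
        ψE (evens A ⊕ evens B) ⊕ ψE (unitE G e)
          ≡⟨ cong₂ _⊕_ (linComb-⊕ edgeEnds (evens A) (evens B)) (ψE-unit e-joins-ba) ⟩
        (ψE (evens A) ⊕ ψE (evens B)) ⊕ (unitV b ⊕ unitV a)
          ≡⟨ ⊕-interchange _ _ _ _ ⟩
        (ψE (evens A) ⊕ unitV b) ⊕ (ψE (evens B) ⊕ unitV a)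
          ≡⟨ cong₂ _⊕_ (odd-alt-image A (proj₁ odd)) (odd-alt-image B (proj₂ odd)) ⟩
        tailMono A ⊕ tailMono B
          ≡⟨ sym tailMono-split ⟩
        tailMono w ∎
        where open ≡-Reasoning

-- Binomial generators of I_Ĝ

module KernelGenerators {c ℓ} (K : Field c ℓ) {n m} (G : Graph n m) (Cs : OddCycleEnumeration G) where
  open Setting K G Cs
  open OddCycleEnumeration Cs using (q)
  open GraphMonomials G using (edgeEnds; ψE)
  open Field K renaming (refl to ≈-refl; sym to ≈-sym; trans to ≈-trans)
  open import Data.Vec.Properties using (lookup-zipWith; lookup-replicate; zipWith-identityˡ)
  open import Function.Bundles using (mk⇔)
  open import Data.List.Membership.Propositional.Properties using (∈-map⁻)
  open PolyProperties commutativeRing _≟Mono_ _·_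
  open MonomialMap commutativeRing _≟Mono_ _·_ _≟V_ _⊕_ ψ using (mapMonomials-resp-≈ₚ; Combination-in-kernel)
  open MonomialMapKernel commutativeRing _≟Mono_ _·_ _≟V_ _⊕_ ψ using (kernel-binomialSum; monomials)

  cyclePair : Fin q → Fin q → Vec ℕ n
  cyclePair i j = cycleMono i ⊕ cycleMono j

  ψΘ : Vec (Vec ℕ q) q → Vec ℕ n
  ψΘ s = sumFin (λ i → linComb (cyclePair i) (lookup s i))

  ψΘ-⊕ : ∀ s t → ψΘ (zipWith _⊕_ s t) ≡ ψΘ s ⊕ ψΘ t
  ψΘ-⊕ s t = trans (sumFin-cong λ i → trans
      (cong (linComb (cyclePair i)) (lookup-zipWith _⊕_ i s t))
      (linComb-⊕ (cyclePair i) (lookup s i) (lookup t i)))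
    (sumFin-⊕ (λ i → linComb (cyclePair i) (lookup s i)) (λ i → linComb (cyclePair i) (lookup t i)))

  ψ-· : ∀ μ ν → ψ (μ · ν) ≡ ψ μ ⊕ ψ ν
  ψ-· (a , s) (b , t) =
    trans (cong₂ _⊕_ (linComb-⊕ edgeEnds a b) (ψΘ-⊕ s t)) (⊕-interchange (ψE a) (ψE b) (ψΘ s) (ψΘ t))

  ψ-edgeMono : ∀ a → ψ (edgeMono a) ≡ ψE a
  ψ-edgeMono a = trans (cong (ψE a ⊕_) ψΘ-zero) (⊕-identityʳ (ψE a))
    where
    ψΘ-zero : ψΘ (replicate q zeroV) ≡ zeroV
    ψΘ-zero = trans (sumFin-cong λ i → trans
        (cong (linComb (cyclePair i)) (lookup-replicate i zeroV)) (linComb-zero (cyclePair i)))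
      (sumFin-zero q)

  edgeMono-valid : ∀ a → ValidMono (edgeMono a)
  edgeMono-valid a i j θᵢⱼ≢0 =
    ⊥-elim (θᵢⱼ≢0 (trans (cong (λ r → lookup r j) (lookup-replicate i zeroV)) (lookup-replicate j 0)))

  1M : Mono
  1M = edgeMono zeroV

  1M-· : ∀ t → 1M · t ≡ t
  1M-· (a , s) = cong₂ _,_ (⊕-identityˡ a) (zipWith-identityˡ ⊕-identityˡ s)

  ideal⊆kernel : ∀ {S} → (∀ t s → S t s → ψ t ≡ ψ s) → ∀ f → KF.InIdeal InKF S f → InI f
  ideal⊆kernel S⊆ker f (h , c , f≈h) w =
    ≈-trans (mapMonomials-resp-≈ₚ {f} {h} f≈h w) (Combination-in-kernel S·⊆ker c w)
    where
    S·⊆ker : ∀ t u → _ → ∀ μ → ψ (μ · t) ≡ ψ (μ · u)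
    S·⊆ker t u Stu μ = trans (ψ-· μ t) (trans (cong (ψ μ ⊕_) (S⊆ker t u Stu)) (sym (ψ-· μ u)))

  generator-inIdeal : ∀ {S} b {t s} → S t s → KF.InIdeal InKF S ((b , t) ∷ (- b , s) ∷ [])
  generator-inIdeal b {t} {s} Sts =
    _ , KF.add ((b , 1M) ∷ []) t s multiplier-valid Sts KF.none ,
    ≈ₚ-∷ (≈-sym (*-identityʳ b)) (sym (1M-· t))
      (≈ₚ-∷ (≈-trans (≈-sym (-1*x≈-x b)) (*-comm (- 1#) b)) (sym (1M-· s)) (λ _ → ≈-refl))
    where
    open import Algebra.Properties.Ring ring using (-1*x≈-x)
    multiplier-valid : InKF ((b , 1M) ∷ [])
    multiplier-valid _ (Any.here refl) = edgeMono-valid zeroV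

  KernelPair : Mono → Mono → Set
  KernelPair t s = ValidMono t × ValidMono s × ψ t ≡ ψ s

  -- A relation whose pairs can always be rerouted through a hub: an edge
  -- monomial in the same fibre that is never part of an excluded pair.
  module AvoidingHubs (Excluded : Mono → Mono → Set) (Hub : Vec ℕ m → Set)
    (hub? : ∀ w → Dec (∃ λ a → Hub a × ψE a ≡ w))
    (hub-not-excluded : ∀ {a} → Hub a → ∀ t → ¬ Excluded (edgeMono a) t × ¬ Excluded t (edgeMono a))
    (excluded-hub : ∀ {t s} → Excluded t s → ∃ λ a → Hub a × ψE a ≡ ψ t) where

    Generator : Mono → Mono → Set
    Generator t s = KernelPair t s × ¬ Excluded t s

    kernelPair-inIdeal : ∀ b {t s} → KernelPair t s → KF.InIdeal InKF Generator ((b , t) ∷ (- b , s) ∷ [])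
    kernelPair-inIdeal b {t} {s} (vt , vs , ψt≡ψs) with hub? (ψ t)
    ... | no noHub = generator-inIdeal b {t} {s} ((vt , vs , ψt≡ψs) , λ ex → noHub (excluded-hub ex))
    ... | yes (a , hub , ψEa≡ψt) =
      InIdeal-resp {f = (b , t) ∷ (- b , s) ∷ []} {(b , t) ∷ (- b , ρ) ∷ (b , ρ) ∷ (- b , s) ∷ []}
        (λ μ → ≈-sym (binomial-detour b t ρ s μ))
        (InIdeal-++ {f = (b , t) ∷ (- b , ρ) ∷ []} {(b , ρ) ∷ (- b , s) ∷ []}
          (generator-inIdeal b {t} {ρ} ((vt , ρ-valid , sym ψρ≡ψt) , proj₂ (hub-not-excluded hub t)))
          (generator-inIdeal b {ρ} {s} ((ρ-valid , vs , trans ψρ≡ψt ψt≡ψs) , proj₁ (hub-not-excluded hub s))))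
      where
      ρ = edgeMono a
      ρ-valid = edgeMono-valid a
      ψρ≡ψt = trans (ψ-edgeMono a) ψEa≡ψt

    binomialSum-inIdeal : ∀ {S h} → (∀ {μ ν} → S μ ν → KernelPair μ ν) →
      BinomialSum S h → KF.InIdeal InKF Generator h
    binomialSum-inIdeal S⊆ []              = [] , KF.none , λ _ → ≈-refl
    binomialSum-inIdeal S⊆ (cons {h} b {μ} {ν} Sμν bs) =
      InIdeal-++ {f = (b , μ) ∷ (- b , ν) ∷ []} {h}
        (kernelPair-inIdeal b {μ} {ν} (S⊆ Sμν)) (binomialSum-inIdeal S⊆ bs)

    kernel⇔ideal : ∀ f → InKF f → (InI f ⇔ KF.InIdeal InKF Generator f)
    kernel⇔ideal f f-valid = mk⇔ kernel⊆ideal (ideal⊆kernel (λ t s g → proj₂ (proj₂ (proj₁ g))) f)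
      where
      valid : ∀ {μ} → μ ∈ monomials f → ValidMono μ
      valid μ∈f with _ , t∈f , refl ← ∈-map⁻ proj₂ μ∈f = f-valid _ t∈f
      kernel⊆ideal : InI f → KF.InIdeal InKF Generator f
      kernel⊆ideal f∈ker with h , bs , f≈h ← kernel-binomialSum f f∈ker =
        InIdeal-resp {f = f} {h} f≈h (binomialSum-inIdeal (λ (μ∈f , ν∈f , eq) → valid μ∈f , valid ν∈f , eq) bs)

-- Mixed even cycles

module MixedCycleBinomials {c ℓ} (K : Field c ℓ) {n m} (G : Graph n m) (Cs : OddCycleEnumeration G)
                           (simple : IsSimple G) (e : Fin m) (u v : Fin n) (e-joins : Joins G e u v)
                           (side : Fin n → Bool) (split : Decomposition.IsSplit G e u v side)
                           (bipartite : Decomposition.PieceBipartite G e u v side true) where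
  open import Data.Nat using (_+_; parity)
  import Data.Nat as ℕ
  open import Data.Nat.Properties using (≤-trans; ≤-reflexive)
  open import Data.Parity using (0ℙ)
  open import Data.Parity.Properties using (+-homo-+; p+p≡0ℙ)
  open import Data.Vec using (tabulate)
  open import Data.Vec.Properties using (lookup∘update′; lookup-replicate; lookup∘tabulate)
  open import Relation.Nullary.Decidable using (_×-dec_)
  open import Data.List.Membership.Propositional using (_∉_)
  open Setting K G Cs
  open Decomposition G e u v side using (MixedEvenCycle)
  open Decomposition.Binomials G e u v side K Cs
  open GraphMonomials G using (ψE; ψE-bound; tailMono; closed-even-alt-image)
  open KernelGenerators K G Cs using (ψ-edgeMono)
  open SeparatingFace G simple e u v e-joins side split
    using (mixed⇒twoSegments; twoSegments-avoid-e; twoSegments-hub)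

  Hub : Vec ℕ m → Set
  Hub a = lookup a e ≢ 0

  even⇒parity : ∀ k → Even k → parity k ≡ 0ℙ
  even⇒parity _ (j , refl) = trans (+-homo-+ j j) (p+p≡0ℙ (parity j))

  alt-avoiding : ∀ {a b} (p : Walk G a b) → e ∉ edges G p →
    lookup (proj₁ (alt G p)) e ≡ 0 × lookup (proj₂ (alt G p)) e ≡ 0
  alt-avoiding []           _   = lookup-replicate e 0 , lookup-replicate e 0
  alt-avoiding (step f j p) e∉ with alt-avoiding p (e∉ ∘ Any.there)
  ... | odds₀ , evens₀ =
    trans (lookup-⊕ (unitE G f) _ e)
      (cong₂ _+_ (trans (lookup∘update′ (e∉ ∘ Any.here) zeroV 1) (lookup-replicate e 0)) evens₀) ,
    odds₀

  mixed-avoids-e : ∀ {t s} → MixedCycleBinomial t s → lookup (proj₁ t) e ≡ 0 × lookup (proj₁ s) e ≡ 0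
  mixed-avoids-e (_ , w , mixed , inj₁ (refl , refl)) = alt-avoiding w (twoSegments-avoid-e (mixed⇒twoSegments w mixed))
  mixed-avoids-e (_ , w , mixed , inj₂ (refl , refl)) =
    let (odds₀ , evens₀) = alt-avoiding w (twoSegments-avoid-e (mixed⇒twoSegments w mixed)) in evens₀ , odds₀

  mixed-cycle-hub : ∀ {x} (w : Walk G x x) → MixedEvenCycle w → ∃ λ a → Hub a × ψE a ≡ tailMono w
  mixed-cycle-hub w mixed@(_ , even , _) = twoSegments-hub (mixed⇒twoSegments w mixed) bipartite (even⇒parity _ even)

  mixed-hub : ∀ {t s} → MixedCycleBinomial t s → ∃ λ a → Hub a × ψE a ≡ ψ t
  mixed-hub (_ , w , mixed@(_ , even , _) , t-s) with a , aₑ≢0 , ψEa ← mixed-cycle-hub w mixed =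
    a , aₑ≢0 , trans ψEa (sym (ψt t-s))
    where
    images = closed-even-alt-image w (even⇒parity _ even)
    ψt : ∀ {t s} → (t ≡ edgeMono (proj₁ (alt G w)) × s ≡ edgeMono (proj₂ (alt G w)))
                 ⊎ (t ≡ edgeMono (proj₂ (alt G w)) × s ≡ edgeMono (proj₁ (alt G w))) → ψ t ≡ tailMono w
    ψt (inj₁ (refl , _)) = trans (ψ-edgeMono (proj₁ (alt G w))) (proj₁ images)
    ψt (inj₂ (refl , _)) = trans (ψ-edgeMono (proj₂ (alt G w))) (proj₂ images)

  hub-not-mixed : ∀ {a} → Hub a → ∀ t → ¬ MixedCycleBinomial (edgeMono a) t × ¬ MixedCycleBinomial t (edgeMono a)
  hub-not-mixed aₑ≢0 t = aₑ≢0 ∘ proj₁ ∘ mixed-avoids-e , aₑ≢0 ∘ proj₂ ∘ mixed-avoids-e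

  hub? : ∀ w → Dec (∃ λ a → Hub a × ψE a ≡ w)
  hub? w = ∃-bounded? (λ a → ¬? (lookup a e ℕ.≟ 0) ×-dec (ψE a ≟V w)) bound
    (λ a (_ , ψEa≡w) f → ≤-trans (ψE-bound a f)
      (≤-reflexive (trans (cong (λ x → lookup x (Graph.src G f)) ψEa≡w) (sym (lookup∘tabulate _ f)))))
    where
    bound : Vec ℕ m
    bound = tabulate (λ f → lookup w (Graph.src G f))

lemma3p4 : ∀ {c ℓ} (K : Field c ℓ) → CharacteristicZero K →
    ∀ {n m} (G : Graph n m) → IsSimple G → Biconnected G →
    ∀ (e : Fin m) (u v : Fin n) → SeparatingFace G e u v →
    ∀ (side : Fin n → Bool) → Decomposition.IsSplit G e u v side →
    Decomposition.PieceBipartite G e u v side true →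
    (Cs : OddCycleEnumeration G) →
    let open Setting K G Cs
        open Decomposition.Binomials G e u v side K Cs
    in ∃ λ (S : Mono → Mono → Set) →
         (∀ t s → S t s → ValidMono t × ValidMono s × (ψ t ≡ ψ s))
         × (∀ t s → S t s → ¬ MixedCycleBinomial t s)
         × (∀ f → InKF f → (InI f ⇔ KF.InIdeal InKF S f))
lemma3p4 K _ G simple _ e u v (e-joins , _) side split bipartite Cs =
  Generator , (λ _ _ → proj₁) , (λ _ _ → proj₂) , kernel⇔ideal
  where
  open MixedCycleBinomials K G Cs simple e u v e-joins side split bipartite
  open KernelGenerators K G Cs
  open AvoidingHubs (Decomposition.Binomials.MixedCycleBinomial G e u v side K Cs) Hub hub? hub-not-mixed mixed-hub
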